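{- Let $\mathcal{M}$ be a finite unitary magma and $m:=\#\mathcal{M}$. For all $n\ge2$, $$\dim\mathrm{NC}\mathcal{M}(n)=\sum_{0\le k\le n-2} m^{n+k+1}(m-1)^{n-k-2}\,\mathrm{nar}(n,k).$$
   Context: A unitary magma $\mathcal{M}$ is a set with binary operation $\star$ and two-sided unit $1_\mathcal{M}$. For $n\ge1$, an $\mathcal{M}$-clique of arity $n$ labels each arc $(x,y)$, $1\le x<y\le n+1$, of a polygon with vertices $1,\dots,n+1$ by an element of $\mathcal{M}$; base $(1,n+1)$, edges $(i,i+1)$, other arcs diagonals. Solid arc: label $\neq1_\mathcal{M}$; noncrossing: no two solid diagonals $(x,y),(x',y')$ with $x<x'<y<y'$ or $x'<x<y'<y$. $\mathrm{NC}\mathcal{M}(n)$ is the vector space with basis the noncrossing $\mathcal{M}$-cliques of arity $n$. The Narayana number $\mathrm{nar}(n,k)$, for $n\ge2$ and $0\le k\le n-2$, is $\frac{1}{k+1}\binom{n-2}{k}\binom{n-1}{k}$, the number of binary trees with $n$ leaves having exactly $k$ internal nodes whose left child is an internal node. -}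

module Defs where

open import Level using (Level; suc; _⊔_)
open import Data.Nat using (ℕ; _+_; _*_; _∸_; _^_; _<_; _≤_)
open import Data.Nat.DivMod using (_/_)
open import Data.Nat.Combinatorics using (_C_)
open import Data.List using (List; []; _∷_; length; concatMap; map; upTo; lookup)
open import Data.Nat.ListAction using (sum)
open import Data.List.Relation.Unary.Unique.Propositional using (Unique)
open import Data.List.Membership.Propositional using (_∈_)
open import Data.Vec using (Vec)
import Data.Vec as Vec
open import Data.Fin using (Fin)
open import Data.Product using (_×_; _,_; ∃; proj₁; proj₂)
open import Data.Sum using (_⊎_)
open import Relation.Nullary using (¬_)
open import Relation.Binary.PropositionalEquality using (_≡_; _≢_)
open import Function.Bundles using (_⇔_)

record UnitaryMagma : Set₁ where
  field
    Carrier : Set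
    _⋆_     : Carrier → Carrier → Carrier
    𝟙       : Carrier
    unitˡ   : ∀ x → 𝟙 ⋆ x ≡ x
    unitʳ   : ∀ x → x ⋆ 𝟙 ≡ x

-- the list of arcs (x , y), 1 ≤ x < y ≤ n + 1, of the polygon with vertices 1 … n+1
arcs : ℕ → List (ℕ × ℕ)
arcs n = concatMap (λ i → map (λ j → (1 + i , 2 + i + j)) (upTo (n ∸ i))) (upTo n)

-- an M-clique of arity n: a label in M for every arc (indexed by position in 'arcs n')
Clique : UnitaryMagma → ℕ → Set
Clique M n = Vec (UnitaryMagma.Carrier M) (length (arcs n))

-- (x , y) is a diagonal: neither an edge (i , i+1) nor the base (1 , n+1)
IsDiagonal : ℕ → ℕ × ℕ → Set
IsDiagonal n (x , y) = (x + 1 < y) × ¬ (x ≡ 1 × y ≡ n + 1)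

Crossing : ℕ × ℕ → ℕ × ℕ → Set
Crossing (x , y) (x' , y') = (x < x' × x' < y × y < y') ⊎ (x' < x × x < y' × y' < y)

Noncrossing : (M : UnitaryMagma) (n : ℕ) → Clique M n → Set
Noncrossing M n c =
  ∀ (i j : Fin (length (arcs n))) →
    IsDiagonal n (lookup (arcs n) i) → IsDiagonal n (lookup (arcs n) j) →
    Vec.lookup c i ≢ UnitaryMagma.𝟙 M → Vec.lookup c j ≢ UnitaryMagma.𝟙 M →
    ¬ Crossing (lookup (arcs n) i) (lookup (arcs n) j)

-- dim NCM(n) = d : the basis (set of noncrossing M-cliques of arity n) has exactly d elements,
-- witnessed by a duplicate-free list enumerating exactly the noncrossing cliques
DimNC≡ : (M : UnitaryMagma) (n d : ℕ) → Set
DimNC≡ M n d = ∃ λ (L : List (Clique M n)) →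
  Unique L × (∀ c → (c ∈ L) ⇔ Noncrossing M n c) × length L ≡ d

-- Narayana number nar(n,k) = (1/(k+1)) binom(n-2,k) binom(n-1,k)   (exact division)
nar : ℕ → ℕ → ℕ
nar n k = (((n ∸ 2) C k) * ((n ∸ 1) C k)) / (1 + k)

formula : ℕ → ℕ → ℕ
formula m n = sum (map (λ k → m ^ (n + k + 1) * (m ∸ 1) ^ (n ∸ k ∸ 2) * nar n k) (upTo (n ∸ 1)))

{-# OPTIONS --safe #-}
-- A noncrossing clique is chosen arc by arc, from the last arc of `arcs n` back to the first: an arc
-- may take any of the m labels, except that a diagonal crossing a solid diagonal chosen before must
-- take the unit. Group the arcs (x , y) into rows by their left end x. The diagonals of a row never
-- cross each other, and all solid diagonals chosen before row x start to the right of x, so (x , y)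
-- is blocked exactly when y lies strictly inside one of them. Hence the number of completions only
-- depends on how many of the vertices x + 1, …, n + 1 are still visible (uncovered), and adding a
-- row expresses the counts with exactly v visible vertices through those with exactly v - 1 and at
-- least v visible vertices one row earlier (TransferRecurrence). After j + 1 rows, the labellings
-- with exactly g + 1 visible vertices, each weighted by m^(g+1), add up to
-- m^(j+3) Σ_u w(j,g,u) m^u (m-1)^(j-u), where
-- w(j,g,u) = C(j,u) C(j-g,u+1-g) - C(j,u+1) C(j-g,u-g) is a determinant of binomial coefficients;
-- summed over g ≥ 1 these determinants are the Narayana numbers nar(j+2,u).
module Submission where

open import Defs
open import Data.Nat using (ℕ; _≤_)
open import Data.Fin using (Fin)
open import Function.Bundles using (_↔_)
open import Data.Nat using (suc; s≤s; z≤n)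
open import Data.Product using (_×_; _,_)
open import Data.List using (List)
open import Data.Integer using (ℤ)
open import Data.List.Relation.Unary.Unique.Propositional using (Unique)
open import Data.List.Membership.Propositional using (_∈_)
open import Relation.Binary.Definitions using (DecidableEquality)
open import Relation.Unary using (Decidable)
open import Relation.Binary.PropositionalEquality using (trans; cong)

module Binomial where
  open import Data.Nat
  open import Data.Nat.Properties
  open import Data.Nat.Combinatorics using (_C_; nCk+nC[k+1]≡[n+1]C[k+1])
  open import Data.Nat.Tactic.RingSolver using (solve-∀)
  open import Relation.Binary.PropositionalEquality
  open ≡-Reasoning

  choose : ℕ → ℕ → ℕ
  choose _       zero    = 1
  choose zero    (suc k) = 0
  choose (suc n) (suc k) = choose n k + choose n (suc k)

  choose≡C : ∀ n k → choose n k ≡ n C k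
  choose≡C n       zero    = refl
  choose≡C zero    (suc k) = refl
  choose≡C (suc n) (suc k) =
    trans (cong₂ _+_ (choose≡C n k) (choose≡C n (suc k))) (nCk+nC[k+1]≡[n+1]C[k+1] n k)

  choose-above : ∀ {n k} → n < k → choose n k ≡ 0
  choose-above {zero}  {suc k} _         = refl
  choose-above {suc n} {suc k} (s≤s n<k) =
    cong₂ _+_ (choose-above n<k) (choose-above (m<n⇒m<1+n n<k))

  choose-diagonal : ∀ n → choose n n ≡ 1
  choose-diagonal zero    = refl
  choose-diagonal (suc n) = cong₂ _+_ (choose-diagonal n) (choose-above (n<1+n n))

  choose-1 : ∀ n → choose n 1 ≡ n
  choose-1 zero    = refl
  choose-1 (suc n) = cong suc (choose-1 n)

  choose-absorption : ∀ n k → suc k * choose (suc n) (suc k) ≡ suc n * choose n k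
  choose-absorption zero    zero    = refl
  choose-absorption zero    (suc k) = *-zeroʳ (suc (suc k))
  choose-absorption (suc n) zero    =
    trans (*-identityˡ _) (trans (choose-1 (suc (suc n))) (sym (*-identityʳ (suc (suc n)))))
  choose-absorption (suc n) (suc k) = begin
    suc (suc k) * (a + b)                          ≡⟨ split a b (suc k) ⟩
    suc k * a + a + suc (suc k) * b                ≡⟨ cong₂ (λ p q → p + a + q) (choose-absorption n k)
                                                                              (choose-absorption n (suc k)) ⟩
    suc n * choose n k + a + suc n * choose n (suc k) ≡⟨ merge (suc n) (choose n k) (choose n (suc k)) ⟩
    suc (suc n) * (choose n k + choose n (suc k))  ∎
    where
    a = choose (suc n) (suc k)
    b = choose (suc n) (suc (suc k))
    split : ∀ a b c → suc c * (a + b) ≡ c * a + a + suc c * b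
    split = solve-∀
    merge : ∀ s a b → s * a + (a + b) + s * b ≡ suc s * (a + b)
    merge = solve-∀

module NarayanaDeterminant (J v : ℕ) where
  open import Data.Nat
  open import Data.Nat.Properties
  open import Data.Nat.DivMod using (_/_; m*n/n≡m)
  open import Data.Nat.Combinatorics using (_C_)
  open import Data.Nat.Tactic.RingSolver using (solve-∀)
  open import Relation.Binary.PropositionalEquality hiding (J)
  open ≡-Reasoning
  open Binomial

  P Q : ℕ
  P = choose (suc J) (suc v) * choose J (suc v)
  Q = choose (suc J) (suc (suc v)) * choose J v

  absorbed : suc v * P ≡ suc (suc v) * Q
  absorbed = begin
    suc v * (choose (suc J) (suc v) * choose J (suc v))        ≡⟨ *-assoc (suc v) (choose (suc J) (suc v)) (choose J (suc v)) ⟨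
    suc v * choose (suc J) (suc v) * choose J (suc v)          ≡⟨ cong (_* choose J (suc v)) (choose-absorption J v) ⟩
    suc J * choose J v * choose J (suc v)                      ≡⟨ swap (suc J) (choose J v) (choose J (suc v)) ⟩
    suc J * choose J (suc v) * choose J v                      ≡⟨ cong (_* choose J v) (choose-absorption J (suc v)) ⟨
    suc (suc v) * choose (suc J) (suc (suc v)) * choose J v    ≡⟨ *-assoc (suc (suc v)) (choose (suc J) (suc (suc v))) (choose J v) ⟩
    suc (suc v) * (choose (suc J) (suc (suc v)) * choose J v)  ∎
    where
    swap : ∀ a b c → a * b * c ≡ a * c * b
    swap = solve-∀

  Q≤P : Q ≤ P
  Q≤P = *-cancelˡ-≤ (suc (suc v)) (subst (_≤ suc (suc v) * P) absorbed (*-monoˡ-≤ P (n≤1+n (suc v))))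

  nar≡P∸Q : nar (suc (suc J)) (suc v) ≡ P ∸ Q
  nar≡P∸Q = begin
    ((J C suc v) * (suc J C suc v)) / suc (suc v)            ≡⟨ cong (λ z → z / suc (suc v)) numerator ⟩
    (P ∸ Q) * suc (suc v) / suc (suc v)                   ≡⟨ m*n/n≡m (P ∸ Q) (suc (suc v)) ⟩
    P ∸ Q                                                 ∎
    where
    scaled : suc (suc v) * (P ∸ Q) ≡ P
    scaled = begin
      suc (suc v) * (P ∸ Q)              ≡⟨ *-distribˡ-∸ (suc (suc v)) P Q ⟩
      P + suc v * P ∸ suc (suc v) * Q    ≡⟨ cong (P + suc v * P ∸_) absorbed ⟨
      P + suc v * P ∸ suc v * P          ≡⟨ m+n∸n≡m P (suc v * P) ⟩
      P                                  ∎
    numerator : (J C suc v) * (suc J C suc v) ≡ (P ∸ Q) * suc (suc v)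
    numerator = begin
      (J C suc v) * (suc J C suc v)              ≡⟨ cong₂ _*_ (choose≡C J (suc v)) (choose≡C (suc J) (suc v)) ⟨
      choose J (suc v) * choose (suc J) (suc v)  ≡⟨ *-comm (choose J (suc v)) _ ⟩
      P                                          ≡⟨ scaled ⟨
      suc (suc v) * (P ∸ Q)                      ≡⟨ *-comm (suc (suc v)) (P ∸ Q) ⟩
      (P ∸ Q) * suc (suc v)                      ∎

-- The upper index is extended to negative integers by (-1-a choose k) = (-1)^k (a+k choose k),
-- which keeps Pascal's rule valid on all of ℤ × ℤ.
module IntegerBinomial where
  open import Data.Nat as ℕ using (zero; suc)
  import Data.Nat.Properties as ℕ
  open import Data.Integer hiding (suc)
  open import Data.Integer.Properties
  open import Data.Integer.Tactic.RingSolver using (solve-∀)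
  open import Relation.Binary.PropositionalEquality
  open Binomial

  alternating : ℕ → ℤ
  alternating zero    = + 1
  alternating (suc k) = - alternating k

  chooseℤ⁺ : ℤ → ℕ → ℤ
  chooseℤ⁺ (+ a)    k = + choose a k
  chooseℤ⁺ -[1+ a ] k = alternating k * + choose (a ℕ.+ k) k

  chooseℤ : ℤ → ℤ → ℤ
  chooseℤ n (+ k)    = chooseℤ⁺ n k
  chooseℤ n -[1+ k ] = + 0

  chooseℤ-pascal : ∀ n k → chooseℤ (n + + 1) k ≡ chooseℤ n k + chooseℤ n (k - + 1)
  chooseℤ-pascal n        -[1+ k ]  = refl
  chooseℤ-pascal (+ a)    (+ zero)  = refl
  chooseℤ-pascal (+ a)    (+ suc k) rewrite ℕ.+-comm a 1 = +-comm (+ choose a k) (+ choose a (suc k))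
  chooseℤ-pascal -[1+ zero ]  (+ zero)  = refl
  chooseℤ-pascal -[1+ suc a ] (+ zero)  = refl
  chooseℤ-pascal -[1+ zero ]  (+ suc k) =
    trans (cancel (alternating k))
          (cong₂ (λ p q → - alternating k * + p + alternating k * + q)
                 (sym (choose-diagonal (suc k))) (sym (choose-diagonal k)))
    where
    cancel : ∀ s → + 0 ≡ - s * + 1 + s * + 1
    cancel = solve-∀
  chooseℤ-pascal -[1+ suc a ] (+ suc k) =
    trans (regroup (alternating k) p q)
          (cong (λ i → - alternating k * (q + p) + alternating k * + choose i k) (ℕ.+-suc a k))
    where
    p = + choose (a ℕ.+ suc k) (suc k)
    q = + choose (a ℕ.+ suc k) k
    regroup : ∀ s p q → - s * p ≡ - s * (q + p) + s * q
    regroup = solve-∀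

  ballot : ℤ → ℤ → ℤ → ℤ
  ballot J G U = chooseℤ J U * chooseℤ (J - G) (U + + 1 - G) - chooseℤ J (U + + 1) * chooseℤ (J - G) (U - G)

  -- closed form of Σ_{g ≥ G} ballot J g U
  ballot≥ : ℤ → ℤ → ℤ → ℤ
  ballot≥ J G U = ballot (J + + 1) G U - ballot J (G - + 1) (U - + 1)

  module Expansion (J G U : ℤ) where
    a₀ a₁ a₂ b₀ b₁ b₂ : ℤ
    a₀ = chooseℤ J (U - + 1)
    a₁ = chooseℤ J U
    a₂ = chooseℤ J (U + + 1)
    b₀ = chooseℤ (J - G) (U + + 1 - G)
    b₁ = chooseℤ (J - G) (U - G)
    b₂ = chooseℤ (J - G) (U - + 1 - G)

    private
      i₁ : ∀ J G → J + + 1 - G ≡ (J - G) + + 1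
      i₁ = solve-∀
      i₂ : ∀ U G → U + + 1 - G - + 1 ≡ U - G
      i₂ = solve-∀
      i₃ : ∀ U G → U - G - + 1 ≡ U - + 1 - G
      i₃ = solve-∀
      i₄ : ∀ J G → J - (G - + 1) ≡ (J - G) + + 1
      i₄ = solve-∀
      i₅ : ∀ U G → U - + 1 + + 1 - (G - + 1) ≡ U + + 1 - G
      i₅ = solve-∀
      i₆ : ∀ U G → U - + 1 - (G - + 1) ≡ U - G
      i₆ = solve-∀
      i₇ : ∀ U → U - + 1 + + 1 ≡ U
      i₇ = solve-∀
      i₈ : ∀ U → U + + 1 - + 1 ≡ U
      i₈ = solve-∀
      i₉ : ∀ J G → J + + 1 - (G + + 1) ≡ J - G
      i₉ = solve-∀
      i₁₀ : ∀ U G → U + + 1 - (G + + 1) ≡ U - G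
      i₁₀ = solve-∀
      i₁₁ : ∀ U G → U - (G + + 1) ≡ U - + 1 - G
      i₁₁ = solve-∀
      i₁₂ : ∀ U G → U - + 1 + + 1 - G ≡ U - G
      i₁₂ = solve-∀

      a₁+a₀ : chooseℤ (J + + 1) U ≡ a₁ + a₀
      a₁+a₀ = chooseℤ-pascal J U
      a₂+a₁ : chooseℤ (J + + 1) (U + + 1) ≡ a₂ + a₁
      a₂+a₁ = trans (chooseℤ-pascal J (U + + 1)) (cong (λ i → a₂ + chooseℤ J i) (i₈ U))
      b₀+b₁ : ∀ {J′ U′} → J′ ≡ (J - G) + + 1 → U′ ≡ U + + 1 - G → chooseℤ J′ U′ ≡ b₀ + b₁
      b₀+b₁ refl refl = trans (chooseℤ-pascal (J - G) (U + + 1 - G)) (cong (λ i → b₀ + chooseℤ (J - G) i) (i₂ U G))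
      b₁+b₂ : ∀ {J′ U′} → J′ ≡ (J - G) + + 1 → U′ ≡ U - G → chooseℤ J′ U′ ≡ b₁ + b₂
      b₁+b₂ refl refl = trans (chooseℤ-pascal (J - G) (U - G)) (cong (λ i → b₁ + chooseℤ (J - G) i) (i₃ U G))

    ballot-suc : ballot (J + + 1) G U ≡ (a₁ + a₀) * (b₀ + b₁) - (a₂ + a₁) * (b₁ + b₂)
    ballot-suc = cong₂ _-_ (cong₂ _*_ a₁+a₀ (b₀+b₁ (i₁ J G) refl)) (cong₂ _*_ a₂+a₁ (b₁+b₂ (i₁ J G) refl))

    ballot-pred : ballot J (G - + 1) (U - + 1) ≡ a₀ * (b₀ + b₁) - a₁ * (b₁ + b₂)
    ballot-pred = cong₂ _-_ (cong (a₀ *_) (b₀+b₁ (i₄ J G) (i₅ U G)))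
                            (cong₂ _*_ (cong (chooseℤ J) (i₇ U)) (b₁+b₂ (i₄ J G) (i₆ U G)))

    ballot-suc-suc : ballot (J + + 1) (G + + 1) U ≡ (a₁ + a₀) * b₁ - (a₂ + a₁) * b₂
    ballot-suc-suc = cong₂ _-_ (cong₂ _*_ a₁+a₀ (cong₂ chooseℤ (i₉ J G) (i₁₀ U G)))
                               (cong₂ _*_ a₂+a₁ (cong₂ chooseℤ (i₉ J G) (i₁₁ U G)))

    ballot-pred-U : ballot J G (U - + 1) ≡ a₀ * b₁ - a₁ * b₂
    ballot-pred-U = cong₂ _-_ (cong (a₀ *_) (cong (chooseℤ (J - G)) (i₁₂ U G))) (cong (_* b₂) (cong (chooseℤ J) (i₇ U)))

  ballot≥-step : ∀ J G U → ballot≥ J G U ≡ ballot J G U + ballot≥ J (G + + 1) U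
  ballot≥-step J G U = begin
    ballot (J + + 1) G U - ballot J (G - + 1) (U - + 1)
      ≡⟨ cong₂ _-_ ballot-suc ballot-pred ⟩
    ((a₁ + a₀) * (b₀ + b₁) - (a₂ + a₁) * (b₁ + b₂)) - (a₀ * (b₀ + b₁) - a₁ * (b₁ + b₂))
      ≡⟨ expand a₀ a₁ a₂ b₀ b₁ b₂ ⟩
    (a₁ * b₀ - a₂ * b₁) + (((a₁ + a₀) * b₁ - (a₂ + a₁) * b₂) - (a₀ * b₁ - a₁ * b₂))
      ≡⟨ cong (λ z → ballot J G U + z)
              (cong₂ _-_ ballot-suc-suc (trans (cong (λ g → ballot J g (U - + 1)) (G+1-1 G)) ballot-pred-U)) ⟨
    ballot J G U + ballot≥ J (G + + 1) U ∎
    where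
    open ≡-Reasoning
    open Expansion J G U
    expand : ∀ a₀ a₁ a₂ b₀ b₁ b₂ →
      ((a₁ + a₀) * (b₀ + b₁) - (a₂ + a₁) * (b₁ + b₂)) - (a₀ * (b₀ + b₁) - a₁ * (b₁ + b₂))
        ≡ (a₁ * b₀ - a₂ * b₁) + (((a₁ + a₀) * b₁ - (a₂ + a₁) * b₂) - (a₀ * b₁ - a₁ * b₂))
    expand = solve-∀
    G+1-1 : ∀ G → G + + 1 - + 1 ≡ G
    G+1-1 = solve-∀

module BallotValues where
  open import Data.Nat as ℕ using (zero; suc; z≤n; s≤s)
  import Data.Nat.Properties as ℕ
  open import Data.Integer hiding (suc; _≤_)
  open import Data.Integer.Properties
  open import Data.Integer.Tactic.RingSolver using (solve-∀)
  import Data.Sign as Sign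
  open import Relation.Binary.PropositionalEquality hiding (J)
  open ≡-Reasoning
  open Binomial
  open IntegerBinomial

  δ₁ : ℕ → ℕ
  δ₁ 1 = 1
  δ₁ _ = 0

  +-suc : ∀ j → + j + + 1 ≡ + suc j
  +-suc j = cong +_ (ℕ.+-comm j 1)

  chooseℤ-negative : ∀ n k → sign k ≡ Sign.- → chooseℤ n k ≡ + 0
  chooseℤ-negative n -[1+ _ ] _ = refl

  chooseℤ-below : ∀ n {p q} → p ℕ.< q → chooseℤ n (+ p - + q) ≡ + 0
  chooseℤ-below n {p} {q} p<q =
    chooseℤ-negative n (+ p - + q) (trans (cong sign ([+m]-[+n]≡m⊖n p q)) (sign-⊖-< p<q))

  chooseℤ-diagonal : ∀ j → chooseℤ (+ j) (+ j) ≡ + 1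
  chooseℤ-diagonal j = cong +_ (choose-diagonal j)

  chooseℤ-above : ∀ j → chooseℤ (+ j) (+ j + + 1) ≡ + 0
  chooseℤ-above j = cong +_ (choose-above (ℕ.m<m+n j (s≤s z≤n)))

  ballot-vanishes : ∀ J G U → chooseℤ (J - G) (U + + 1 - G) ≡ + 0 → chooseℤ (J - G) (U - G) ≡ + 0 →
                    ballot J G U ≡ + 0
  ballot-vanishes J G U c d =
    trans (cong₂ (λ c d → chooseℤ J U * c - chooseℤ J (U + + 1) * d) c d) (zeros (chooseℤ J U) (chooseℤ J (U + + 1)))
    where
    zeros : ∀ a b → a * + 0 - b * + 0 ≡ + 0
    zeros = solve-∀

  ballot≥-vanishes : ∀ J {g u} → suc (suc u) ℕ.≤ g → ballot≥ J (+ g) (+ u) ≡ + 0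
  ballot≥-vanishes J {g} {u} u+2≤g = cong₂ _-_ upper lower
    where
    u+1<g : u ℕ.+ 1 ℕ.< g
    u+1<g = subst (ℕ._< g) (ℕ.+-comm 1 u) u+2≤g
    u<g : u ℕ.< g
    u<g = ℕ.<-trans (ℕ.n<1+n u) u+2≤g
    i₁ : ∀ U G → U - + 1 + + 1 - (G - + 1) ≡ U + + 1 - G
    i₁ = solve-∀
    i₂ : ∀ U G → U - + 1 - (G - + 1) ≡ U - G
    i₂ = solve-∀
    upper : ballot (J + + 1) (+ g) (+ u) ≡ + 0
    upper = ballot-vanishes (J + + 1) (+ g) (+ u) (chooseℤ-below (J + + 1 - + g) u+1<g) (chooseℤ-below (J + + 1 - + g) u<g)
    lower : ballot J (+ g - + 1) (+ u - + 1) ≡ + 0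
    lower = ballot-vanishes J (+ g - + 1) (+ u - + 1)
              (trans (cong (chooseℤ J′) (i₁ (+ u) (+ g))) (chooseℤ-below J′ u+1<g))
              (trans (cong (chooseℤ J′) (i₂ (+ u) (+ g))) (chooseℤ-below J′ u<g))
      where J′ = J - (+ g - + 1)

  ballot-0 : ∀ J U → ballot J (+ 0) U ≡ + 0
  ballot-0 J U =
    trans (cong₂ (λ c d → chooseℤ J U * c - chooseℤ J (U + + 1) * d)
                 (cong₂ chooseℤ (+-identityʳ J) (+-identityʳ (U + + 1)))
                 (cong₂ chooseℤ (+-identityʳ J) (+-identityʳ U)))
          (commute (chooseℤ J U) (chooseℤ J (U + + 1)))
    where
    commute : ∀ a b → a * b - b * a ≡ + 0
    commute = solve-∀

  ballot-at-−1 : ∀ J g → ballot J (+ g) -[1+ 0 ] ≡ + 0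
  ballot-at-−1 J g =
    trans (cong (λ d → + 0 * chooseℤ (J - + g) (-[1+ 0 ] + + 1 - + g) - chooseℤ J (-[1+ 0 ] + + 1) * d) (below g))
          (zeros (chooseℤ (J - + g) (-[1+ 0 ] + + 1 - + g)) (chooseℤ J (-[1+ 0 ] + + 1)))
    where
    below : ∀ g → chooseℤ (J - + g) (-[1+ 0 ] - + g) ≡ + 0
    below zero    = refl
    below (suc g) = refl
    zeros : ∀ c b → + 0 * c - b * + 0 ≡ + 0
    zeros = solve-∀

  ballot≥-top : ∀ j G → ballot≥ (+ j) G (+ suc j) ≡ + 0
  ballot≥-top j G = begin
    ballot≥ J G (+ suc j)                                          ≡⟨ cong (ballot≥ J G) (+-suc j) ⟨
    ballot (J + + 1) G (J + + 1) - ballot J (G - + 1) (J + + 1 - + 1) ≡⟨ cong₂ _-_ upper lower ⟩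
    (+ 1 * B - + 0 * c) - (+ 1 * B - + 0 * d)                     ≡⟨ cancel B c d ⟩
    + 0                                                            ∎
    where
    J : ℤ
    J = + j
    B = chooseℤ (J - (G - + 1)) (J + + 1 - (G - + 1))
    c = chooseℤ (J + + 1 - G) (J + + 1 - G)
    d = chooseℤ (J - (G - + 1)) (J + + 1 - + 1 - (G - + 1))
    cancel : ∀ B c d → (+ 1 * B - + 0 * c) - (+ 1 * B - + 0 * d) ≡ + 0
    cancel = solve-∀
    t₁ : ∀ J G → J + + 1 - G ≡ J - (G - + 1)
    t₁ = solve-∀
    t₂ : ∀ J G → J + + 1 + + 1 - G ≡ J + + 1 - (G - + 1)
    t₂ = solve-∀
    t₃ : ∀ J → J + + 1 - + 1 ≡ J
    t₃ = solve-∀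
    upper : ballot (J + + 1) G (J + + 1) ≡ + 1 * B - + 0 * c
    upper = cong₂ _-_ (cong₂ _*_ (chooseℤ-diagonal (j ℕ.+ 1)) (cong₂ chooseℤ (t₁ J G) (t₂ J G)))
                      (cong (_* c) (chooseℤ-above (j ℕ.+ 1)))
    lower : ballot J (G - + 1) (J + + 1 - + 1) ≡ + 1 * B - + 0 * d
    lower = cong₂ _-_ (cong₂ _*_ (trans (cong (chooseℤ J) (t₃ J)) (chooseℤ-diagonal j))
                                 (cong (λ v → chooseℤ (J - (G - + 1)) (v + + 1 - (G - + 1))) (t₃ J)))
                      (cong (_* d) (trans (cong (λ v → chooseℤ J (v + + 1)) (t₃ J)) (chooseℤ-above j)))

  ballot-origin : ∀ g → ballot (+ 0) (+ g) (+ 0) ≡ + δ₁ g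
  ballot-origin zero          = refl
  ballot-origin (suc zero)    = refl
  ballot-origin (suc (suc g)) = refl

  ballot-suc : ∀ j G U → ballot (+ suc j) G U ≡ ballot (+ j) (G - + 1) (U - + 1) + ballot≥ (+ j) G U
  ballot-suc j G U =
    trans (cong (λ J → ballot J G U) (sym (+-suc j))) (split (ballot (+ j + + 1) G U) (ballot (+ j) (G - + 1) (U - + 1)))
    where
    split : ∀ x y → x ≡ y + (x - y)
    split = solve-∀

  ballot≥-narayana : ∀ J u → ballot≥ (+ J) (+ 1) (+ u) ≡ + nar (suc (suc J)) u
  ballot≥-narayana J u =
    trans (cong₂ _-_ (cong (λ K → ballot K (+ 1) (+ u)) (+-suc J)) (ballot-0 (+ J) (+ u - + 1)))
          (trans (+-identityʳ _) (at u))
    where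
    at : ∀ u → ballot (+ suc J) (+ 1) (+ u) ≡ + nar (suc (suc J)) u
    at zero    = one (chooseℤ (+ suc J) (+ 1))
      where
      one : ∀ b → + 1 * + 1 - b * + 0 ≡ + 1
      one = solve-∀
    at (suc v) = begin
      chooseℤ (+ suc J) (+ suc v) * chooseℤ (+ J) (+ suc v + + 1 - + 1) - chooseℤ (+ suc J) (+ suc v + + 1) * chooseℤ (+ J) (+ v)
        ≡⟨ cong₂ (λ i k → chooseℤ (+ suc J) (+ suc v) * chooseℤ (+ J) i - chooseℤ (+ suc J) k * chooseℤ (+ J) (+ v))
                 (+-suc v) (+-suc (suc v)) ⟩
      + choose (suc J) (suc v) * + choose J (suc v) - + choose (suc J) (suc (suc v)) * + choose J v
        ≡⟨ cong₂ _-_ (pos-* (choose (suc J) (suc v)) (choose J (suc v))) (pos-* (choose (suc J) (suc (suc v))) (choose J v)) ⟨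
      + P - + Q                 ≡⟨ [+m]-[+n]≡m⊖n P Q ⟩
      P ⊖ Q                     ≡⟨ ⊖-≥ Q≤P ⟩
      + (P ℕ.∸ Q)               ≡⟨ cong +_ nar≡P∸Q ⟨
      + nar (suc (suc J)) (suc v) ∎
      where open NarayanaDeterminant J v

module ListSum where
  open import Data.Nat
  open import Data.Nat.Properties
  open import Data.Nat.ListAction using (sum)
  open import Data.Nat.ListAction.Properties using (sum-++)
  open import Data.Nat.Tactic.RingSolver using (solve-∀)
  open import Data.List using (List; []; _∷_; map; concatMap; length)
  open import Data.List.Properties using (map-++)
  open import Data.List.Membership.Propositional using (_∈_)
  open import Data.List.Relation.Unary.Any using (here; there)
  open import Relation.Binary.PropositionalEquality

  module _ {A : Set} where

    sum-map-+ : ∀ (f g : A → ℕ) xs → sum (map (λ x → f x + g x) xs) ≡ sum (map f xs) + sum (map g xs)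
    sum-map-+ f g []       = refl
    sum-map-+ f g (x ∷ xs) =
      trans (cong (f x + g x +_) (sum-map-+ f g xs)) (interchange (f x) (g x) (sum (map f xs)) (sum (map g xs)))
      where
      interchange : ∀ a b c d → a + b + (c + d) ≡ a + c + (b + d)
      interchange = solve-∀

    sum-map-* : ∀ k (f : A → ℕ) xs → sum (map (λ x → k * f x) xs) ≡ k * sum (map f xs)
    sum-map-* k f []       = sym (*-zeroʳ k)
    sum-map-* k f (x ∷ xs) = trans (cong (k * f x +_) (sum-map-* k f xs)) (sym (*-distribˡ-+ k (f x) (sum (map f xs))))

    sum-map-const : ∀ (f : A → ℕ) k xs → (∀ x → x ∈ xs → f x ≡ k) → sum (map f xs) ≡ length xs * k
    sum-map-const f k []       _ = refl
    sum-map-const f k (x ∷ xs) h = cong₂ _+_ (h x (here refl)) (sum-map-const f k xs (λ y y∈ → h y (there y∈)))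

    sum-map-concatMap : ∀ {B : Set} (g : B → ℕ) (f : A → List B) xs →
                        sum (map g (concatMap f xs)) ≡ sum (map (λ x → sum (map g (f x))) xs)
    sum-map-concatMap g f []       = refl
    sum-map-concatMap g f (x ∷ xs) =
      trans (cong sum (map-++ g (f x) (concatMap f xs)))
            (trans (sum-++ (map g (f x)) (map g (concatMap f xs)))
                   (cong (sum (map g (f x)) +_) (sum-map-concatMap g f xs)))

-- hom j f = Σ_{u ≤ j} f u · M^u X^(j-u)
module Homogeneous (M X : ℤ) where
  open import Data.Nat as ℕ using (zero; suc; z≤n; s≤s)
  open import Data.Integer hiding (suc; _≤_)
  open import Data.Integer.Tactic.RingSolver using (solve-∀)
  open import Relation.Binary.PropositionalEquality

  hom : ℕ → (ℕ → ℤ) → ℤ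
  hom zero    f = f 0
  hom (suc j) f = f 0 * X ^ suc j + M * hom j (λ u → f (suc u))

  hom-cong : ∀ j f g → (∀ u → u ℕ.≤ j → f u ≡ g u) → hom j f ≡ hom j g
  hom-cong zero    f g f≗g = f≗g 0 z≤n
  hom-cong (suc j) f g f≗g =
    cong₂ (λ p q → p * X ^ suc j + M * q) (f≗g 0 z≤n) (hom-cong j _ _ (λ u u≤j → f≗g (suc u) (s≤s u≤j)))

  hom-+ : ∀ j f g → hom j (λ u → f u + g u) ≡ hom j f + hom j g
  hom-+ zero    f g = refl
  hom-+ (suc j) f g =
    trans (cong (λ q → (f 0 + g 0) * X ^ suc j + M * q) (hom-+ j _ _))
          (distrib (f 0) (g 0) (X ^ suc j) M (hom j (λ u → f (suc u))) (hom j (λ u → g (suc u))))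
    where
    distrib : ∀ a b P M c d → (a + b) * P + M * (c + d) ≡ (a * P + M * c) + (b * P + M * d)
    distrib = solve-∀

  hom-0 : ∀ j → hom j (λ _ → + 0) ≡ + 0
  hom-0 zero    = refl
  hom-0 (suc j) = trans (cong (λ q → + 0 * X ^ suc j + M * q) (hom-0 j)) (zeros (X ^ suc j) M)
    where
    zeros : ∀ P M → + 0 * P + M * + 0 ≡ + 0
    zeros = solve-∀

  hom-suc : ∀ j f → hom (suc j) f ≡ X * hom j f + f (suc j) * M ^ suc j
  hom-suc zero    f = peel (f 0) (f 1) X M
    where
    peel : ∀ f₀ f₁ X M → f₀ * (X * + 1) + M * f₁ ≡ X * f₀ + f₁ * (M * + 1)
    peel = solve-∀
  hom-suc (suc j) f =
    trans (cong (λ q → f 0 * X ^ suc (suc j) + M * q) (hom-suc j (λ u → f (suc u))))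
          (peel (f 0) X (X ^ suc j) M (M ^ suc j) (hom j (λ u → f (suc u))) (f (suc (suc j))))
    where
    peel : ∀ f₀ X Xʲ M Mʲ h f′ → f₀ * (X * Xʲ) + M * (X * h + f′ * Mʲ) ≡ X * (f₀ * Xʲ + M * h) + f′ * (M * Mʲ)
    peel = solve-∀

module HomogeneousPolynomial (m : ℕ) where
  import Data.Nat as ℕ
  open import Data.Nat using (zero; suc)
  import Data.Nat.Properties as ℕ
  open import Data.Nat.ListAction using (sum)
  open import Data.List using (map; upTo; applyUpTo)
  open import Data.List.Properties using (map-upTo; map-cong)
  open import Data.Integer hiding (suc; _≤_)
  open import Data.Integer.Properties
  import Data.Nat.Tactic.RingSolver as ℕ-Solver
  open import Relation.Binary.PropositionalEquality
  open ≡-Reasoning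
  open ListSum

  M X : ℤ
  M = + m
  X = + (m ℕ.∸ 1)

  open Homogeneous M X public

  pos-^ : ∀ b k → + (b ℕ.^ k) ≡ (+ b) ^ k
  pos-^ b zero    = refl
  pos-^ b (suc k) = trans (pos-* b (b ℕ.^ k)) (cong (+ b *_) (pos-^ b k))

  weightedSum : ℕ → (ℕ → ℕ) → ℕ
  weightedSum j f = sum (map (λ u → f u ℕ.* m ℕ.^ u ℕ.* (m ℕ.∸ 1) ℕ.^ (j ℕ.∸ u)) (upTo (suc j)))

  weightedSum-suc : ∀ j f →
    weightedSum (suc j) f ≡ f 0 ℕ.* (m ℕ.∸ 1) ℕ.^ suc j ℕ.+ m ℕ.* weightedSum j (λ u → f (suc u))
  weightedSum-suc j f = begin
    sum (map g (upTo (suc (suc j))))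
      ≡⟨ cong sum (map-upTo g (suc (suc j))) ⟩
    g 0 ℕ.+ sum (applyUpTo (λ u → g (suc u)) (suc j))
      ≡⟨ cong₂ (λ a xs → a ℕ.* (m ℕ.∸ 1) ℕ.^ suc j ℕ.+ sum xs)
               (ℕ.*-identityʳ (f 0)) (sym (map-upTo (λ u → g (suc u)) (suc j))) ⟩
    f 0 ℕ.* (m ℕ.∸ 1) ℕ.^ suc j ℕ.+ sum (map (λ u → g (suc u)) (upTo (suc j)))
      ≡⟨ cong (λ xs → f 0 ℕ.* (m ℕ.∸ 1) ℕ.^ suc j ℕ.+ sum xs)
              (map-cong (λ u → shuffle (f (suc u)) m (m ℕ.^ u) ((m ℕ.∸ 1) ℕ.^ (j ℕ.∸ u))) (upTo (suc j))) ⟩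
    f 0 ℕ.* (m ℕ.∸ 1) ℕ.^ suc j ℕ.+
      sum (map (λ u → m ℕ.* (f (suc u) ℕ.* m ℕ.^ u ℕ.* (m ℕ.∸ 1) ℕ.^ (j ℕ.∸ u))) (upTo (suc j)))
      ≡⟨ cong (f 0 ℕ.* (m ℕ.∸ 1) ℕ.^ suc j ℕ.+_) (sum-map-* m _ (upTo (suc j))) ⟩
    f 0 ℕ.* (m ℕ.∸ 1) ℕ.^ suc j ℕ.+ m ℕ.* weightedSum j (λ u → f (suc u)) ∎
    where
    g : ℕ → ℕ
    g u = f u ℕ.* m ℕ.^ u ℕ.* (m ℕ.∸ 1) ℕ.^ (suc j ℕ.∸ u)
    shuffle : ∀ a m p q → a ℕ.* (m ℕ.* p) ℕ.* q ≡ m ℕ.* (a ℕ.* p ℕ.* q)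
    shuffle = ℕ-Solver.solve-∀

  hom-pos : ∀ j f → hom j (λ u → + f u) ≡ + weightedSum j f
  hom-pos zero    f = cong +_ (unit (f 0))
    where
    unit : ∀ a → a ≡ a ℕ.* 1 ℕ.* 1 ℕ.+ 0
    unit = ℕ-Solver.solve-∀
  hom-pos (suc j) f = begin
    + f 0 * X ^ suc j + M * hom j (λ u → + f (suc u))
      ≡⟨ cong₂ (λ p q → + f 0 * p + M * q) (pos-^ (m ℕ.∸ 1) (suc j)) (sym (hom-pos j (λ u → f (suc u)))) ⟨
    + f 0 * + ((m ℕ.∸ 1) ℕ.^ suc j) + M * + weightedSum j (λ u → f (suc u))
      ≡⟨ cong₂ _+_ (pos-* (f 0) _) (pos-* m _) ⟨
    + (f 0 ℕ.* (m ℕ.∸ 1) ℕ.^ suc j) + + (m ℕ.* weightedSum j (λ u → f (suc u)))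
      ≡⟨ pos-+ (f 0 ℕ.* (m ℕ.∸ 1) ℕ.^ suc j) _ ⟨
    + (f 0 ℕ.* (m ℕ.∸ 1) ℕ.^ suc j ℕ.+ m ℕ.* weightedSum j (λ u → f (suc u)))
      ≡⟨ cong +_ (weightedSum-suc j f) ⟨
    + weightedSum (suc j) f ∎

  formula≡weightedSum : ∀ J → formula m (suc (suc J)) ≡ m ℕ.^ (3 ℕ.+ J) ℕ.* weightedSum J (nar (suc (suc J)))
  formula≡weightedSum J =
    trans (cong sum (map-cong term (upTo (suc J)))) (sum-map-* (m ℕ.^ (3 ℕ.+ J)) _ (upTo (suc J)))
    where
    exponent : ∀ J k → suc (suc J) ℕ.+ k ℕ.+ 1 ≡ (3 ℕ.+ J) ℕ.+ k
    exponent = ℕ-Solver.solve-∀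
    shuffle : ∀ a b c n → a ℕ.* b ℕ.* c ℕ.* n ≡ a ℕ.* (n ℕ.* b ℕ.* c)
    shuffle = ℕ-Solver.solve-∀
    term : ∀ k →
      m ℕ.^ (suc (suc J) ℕ.+ k ℕ.+ 1) ℕ.* (m ℕ.∸ 1) ℕ.^ (suc (suc J) ℕ.∸ k ℕ.∸ 2) ℕ.* nar (suc (suc J)) k
               ≡ m ℕ.^ (3 ℕ.+ J) ℕ.* (nar (suc (suc J)) k ℕ.* m ℕ.^ k ℕ.* (m ℕ.∸ 1) ℕ.^ (J ℕ.∸ k))
    term k = trans
      (cong₂ (λ p q → p ℕ.* q ℕ.* nar (suc (suc J)) k)
             (trans (cong (m ℕ.^_) (exponent J k)) (ℕ.^-distribˡ-+-* m (3 ℕ.+ J) k))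
             (cong ((m ℕ.∸ 1) ℕ.^_) (trans (ℕ.∸-+-assoc (suc (suc J)) k 2) (cong (suc (suc J) ℕ.∸_) (ℕ.+-comm k 2)))))
      (shuffle (m ℕ.^ (3 ℕ.+ J)) (m ℕ.^ k) ((m ℕ.∸ 1) ℕ.^ (J ℕ.∸ k)) (nar (suc (suc J)) k))

module Transfer where
  open import Data.Nat as ℕ using (zero; suc; _<_; s≤s)
  import Data.Nat.Properties as ℕ
  open import Data.Integer hiding (suc; _≤_; _<_)
  open import Data.Integer.Properties
  open import Data.Integer.Tactic.RingSolver using (solve-∀)
  open import Relation.Binary.PropositionalEquality
  open ≡-Reasoning
  open IntegerBinomial
  open BallotValues

  record TransferRecurrence (m J : ℕ) (N A : ℕ → ℕ → ℕ) : Set where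
    field
      N-initial : ∀ g → N 0 g ≡ m ℕ.^ 3 ℕ.* δ₁ g
      N-zero    : ∀ j → j ≤ J → N j 0 ≡ 0
      N-suc     : ∀ j g → j < J →
                  N (suc j) (suc g) ≡ m ℕ.* m ℕ.* N j g ℕ.+ (m ℕ.∸ 1) ℕ.* m ℕ.* A j (suc g)
      A-split   : ∀ j g → A j g ≡ N j g ℕ.+ A j (suc g)
      A-vanish  : ∀ j g → suc (suc j) ≤ g → A j g ≡ 0

  module BallotPolynomial (M X : ℤ) where
    open Homogeneous M X

    Ballot Ballot≥ : ℕ → ℕ → ℤ
    Ballot  j g = hom j (λ u → ballot (+ j) (+ g) (+ u))
    Ballot≥ j g = hom j (λ u → ballot≥ (+ j) (+ g) (+ u))

    Ballot≥-step : ∀ j g → Ballot≥ j g ≡ Ballot j g + Ballot≥ j (suc g)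
    Ballot≥-step j g =
      trans (hom-cong j _ _ (λ u _ → trans (ballot≥-step (+ j) (+ g) (+ u))
                                           (cong (λ G → ballot (+ j) (+ g) (+ u) + ballot≥ (+ j) G (+ u)) (+-suc g))))
            (hom-+ j _ _)

    Ballot≥-vanishes : ∀ j g → suc (suc j) ≤ g → Ballot≥ j g ≡ + 0
    Ballot≥-vanishes j g j+2≤g =
      trans (hom-cong j _ _ (λ u u≤j → ballot≥-vanishes (+ j) (ℕ.≤-trans (s≤s (s≤s u≤j)) j+2≤g))) (hom-0 j)

    Ballot-0 : ∀ j → Ballot j 0 ≡ + 0
    Ballot-0 j = trans (hom-cong j _ _ (λ u _ → ballot-0 (+ j) (+ u))) (hom-0 j)

    Ballot-suc : ∀ j g → Ballot (suc j) (suc g) ≡ M * Ballot j g + X * Ballot≥ j (suc g)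
    Ballot-suc j g = begin
      Ballot (suc j) (suc g)
        ≡⟨ hom-cong (suc j) _ _ (λ u _ → ballot-suc j (+ suc g) (+ u)) ⟩
      hom (suc j) (λ u → ballot (+ j) (+ g) (+ u - + 1) + ballot≥ (+ j) (+ suc g) (+ u))
        ≡⟨ hom-+ (suc j) (λ u → ballot (+ j) (+ g) (+ u - + 1)) (λ u → ballot≥ (+ j) (+ suc g) (+ u)) ⟩
      hom (suc j) (λ u → ballot (+ j) (+ g) (+ u - + 1)) + hom (suc j) (λ u → ballot≥ (+ j) (+ suc g) (+ u))
        ≡⟨ cong₂ _+_ (cong (λ b → b * X ^ suc j + M * Ballot j g) (ballot-at-−1 (+ j) g))
                     (trans (hom-suc j _) (cong (λ b → X * Ballot≥ j (suc g) + b * M ^ suc j) (ballot≥-top j (+ suc g)))) ⟩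
      (+ 0 * X ^ suc j + M * Ballot j g) + (X * Ballot≥ j (suc g) + + 0 * M ^ suc j)
        ≡⟨ drop (X ^ suc j) (M ^ suc j) (M * Ballot j g) (X * Ballot≥ j (suc g)) ⟩
      M * Ballot j g + X * Ballot≥ j (suc g) ∎
      where
      drop : ∀ p q a b → (+ 0 * p + a) + (b + + 0 * q) ≡ a + b
      drop = solve-∀

  module Solution {m J : ℕ} {N A : ℕ → ℕ → ℕ} (R : TransferRecurrence m J N A) where
    open TransferRecurrence R
    open HomogeneousPolynomial m
    open BallotPolynomial M X

    scale : ℕ → ℤ
    scale j = M ^ (3 ℕ.+ j)

    A-closed : ∀ j → (∀ g → + N j g ≡ scale j * Ballot j g) → ∀ g → + A j g ≡ scale j * Ballot≥ j g
    A-closed j N-closed g = down (suc (suc j)) g (ℕ.m≤n+m _ g)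
      where
      -- downward induction on g, from g ≥ j + 2 where both sides vanish
      down : ∀ t g → suc (suc j) ≤ g ℕ.+ t → + A j g ≡ scale j * Ballot≥ j g
      down zero g j+2≤g =
        trans (cong +_ (A-vanish j g j+2≤g′))
              (sym (trans (cong (scale j *_) (Ballot≥-vanishes j g j+2≤g′)) (*-zeroʳ (scale j))))
        where
        j+2≤g′ : suc (suc j) ≤ g
        j+2≤g′ = subst (suc (suc j) ≤_) (ℕ.+-identityʳ g) j+2≤g
      down (suc t) g j+2≤g+t = begin
        + A j g                                     ≡⟨ cong +_ (A-split j g) ⟩
        + (N j g ℕ.+ A j (suc g))                   ≡⟨ pos-+ (N j g) (A j (suc g)) ⟩
        + N j g + + A j (suc g)
          ≡⟨ cong₂ _+_ (N-closed g) (down t (suc g) (subst (suc (suc j) ≤_) (ℕ.+-suc g t) j+2≤g+t)) ⟩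
        scale j * Ballot j g + scale j * Ballot≥ j (suc g) ≡⟨ *-distribˡ-+ (scale j) _ _ ⟨
        scale j * (Ballot j g + Ballot≥ j (suc g))  ≡⟨ cong (scale j *_) (Ballot≥-step j g) ⟨
        scale j * Ballot≥ j g                       ∎

    N-closed : ∀ j → j ≤ J → ∀ g → + N j g ≡ scale j * Ballot j g
    N-closed zero    _   g = begin
      + N 0 g                   ≡⟨ cong +_ (N-initial g) ⟩
      + (m ℕ.^ 3 ℕ.* δ₁ g)      ≡⟨ pos-* (m ℕ.^ 3) (δ₁ g) ⟩
      + (m ℕ.^ 3) * + δ₁ g      ≡⟨ cong₂ _*_ (pos-^ m 3) (sym (ballot-origin g)) ⟩
      scale 0 * Ballot 0 g      ∎
    N-closed (suc j) j<J zero =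
      trans (cong +_ (N-zero (suc j) j<J))
            (sym (trans (cong (scale (suc j) *_) (Ballot-0 (suc j))) (*-zeroʳ (scale (suc j)))))
    N-closed (suc j) j<J (suc g) = begin
      + N (suc j) (suc g)
        ≡⟨ cong +_ (N-suc j g j<J) ⟩
      + (m ℕ.* m ℕ.* N j g ℕ.+ (m ℕ.∸ 1) ℕ.* m ℕ.* A j (suc g))
        ≡⟨ pos-+ (m ℕ.* m ℕ.* N j g) _ ⟩
      + (m ℕ.* m ℕ.* N j g) + + ((m ℕ.∸ 1) ℕ.* m ℕ.* A j (suc g))
        ≡⟨ cong₂ _+_ (trans (pos-* (m ℕ.* m) (N j g)) (cong₂ _*_ (pos-* m m) (N-closed j j≤J g)))
                     (trans (pos-* ((m ℕ.∸ 1) ℕ.* m) (A j (suc g)))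
                            (cong₂ _*_ (pos-* (m ℕ.∸ 1) m) (A-closed j (N-closed j j≤J) (suc g)))) ⟩
      M * M * (scale j * Ballot j g) + X * M * (scale j * Ballot≥ j (suc g))
        ≡⟨ factor M X (scale j) (Ballot j g) (Ballot≥ j (suc g)) ⟩
      scale (suc j) * (M * Ballot j g + X * Ballot≥ j (suc g))
        ≡⟨ cong (scale (suc j) *_) (Ballot-suc j g) ⟨
      scale (suc j) * Ballot (suc j) (suc g) ∎
      where
      j≤J = ℕ.<⇒≤ j<J
      factor : ∀ M X P b a → M * M * (P * b) + X * M * (P * a) ≡ (M * P) * (M * b + X * a)
      factor = solve-∀

  transfer-solution : ∀ {m J N A} → TransferRecurrence m J N A → A J 1 ≡ formula m (suc (suc J))
  transfer-solution {m} {J} {N} {A} R = +-injective (begin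
    + A J 1
      ≡⟨ A-closed J (N-closed J ℕ.≤-refl) 1 ⟩
    scale J * Ballot≥ J 1
      ≡⟨ cong (scale J *_) (hom-cong J _ _ (λ u _ → ballot≥-narayana J u)) ⟩
    scale J * hom J (λ u → + nar (suc (suc J)) u)
      ≡⟨ cong₂ _*_ (pos-^ m (3 ℕ.+ J)) (sym (hom-pos J (nar (suc (suc J))))) ⟨
    + (m ℕ.^ (3 ℕ.+ J)) * + weightedSum J (nar (suc (suc J)))
      ≡⟨ pos-* (m ℕ.^ (3 ℕ.+ J)) _ ⟨
    + (m ℕ.^ (3 ℕ.+ J) ℕ.* weightedSum J (nar (suc (suc J))))
      ≡⟨ cong +_ (formula≡weightedSum J) ⟨
    + formula m (suc (suc J)) ∎)
    where
    open Solution R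
    open HomogeneousPolynomial m
    open BallotPolynomial M X

Arc : Set
Arc = ℕ × ℕ

-- Labellings are enumerated from the last arc of the list backwards; a diagonal may only become
-- solid if it crosses none of the solid diagonals already chosen further down the list.
module Enumeration {A : Set} (_≟_ : DecidableEquality A) (unit : A) (elements : List A)
  (elements-unique : Unique elements) (elements-complete : ∀ x → x ∈ elements)
  (Diagonal : Arc → Set) (diagonal? : Decidable Diagonal) where

  open import Data.Nat hiding (_≟_)
  open import Data.Nat.Properties hiding (_≟_)
  open import Data.Nat.ListAction using (sum)
  open import Data.List using ([]; _∷_; _++_; length; map; concatMap; filter; lookup)
  import Data.List.Properties as List
  open import Data.List.Relation.Unary.Any as Any using (Any; here; there; any?)
  open import Data.List.Relation.Unary.All as All using (All; []; _∷_)
  open import Data.List.Relation.Unary.AllPairs using ([]; _∷_)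
  import Data.List.Relation.Unary.Unique.Propositional.Properties as Unique
  open import Data.List.Membership.Propositional using (find)
  open import Data.List.Membership.Propositional.Properties
    using (∈-map⁺; ∈-map⁻; ∈-filter⁺; ∈-filter⁻; ∈-concatMap⁺; ∈-concatMap⁻)
  open import Data.Vec as Vec using (Vec; []; _∷_)
  open import Data.Vec.Properties using (∷-injective; ∷-injectiveˡ; ∷-injectiveʳ)
  open import Data.Fin using (Fin; zero; suc)
  open import Data.Product using (Σ; _,_; proj₂)
  open import Data.Sum using (inj₁; inj₂)
  open import Data.Unit using (⊤; tt)
  open import Relation.Nullary using (¬_; Dec; yes; no; ¬?; contradiction)
  open import Relation.Nullary.Decidable using (_×-dec_; _⊎-dec_)
  open import Relation.Binary.PropositionalEquality
  open import Function.Bundles using (_⇔_; mk⇔)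
  open ListSum

  m : ℕ
  m = length elements

  crossing? : (p q : Arc) → Dec (Crossing p q)
  crossing? (x , y) (x′ , y′) =
    ((x <? x′) ×-dec ((x′ <? y) ×-dec (y <? y′))) ⊎-dec ((x′ <? x) ×-dec ((x <? y′) ×-dec (y′ <? y)))

  crossing-sym : ∀ p q → Crossing p q → Crossing q p
  crossing-sym p q (inj₁ c) = inj₂ c
  crossing-sym p q (inj₂ c) = inj₁ c

  crossing-irrefl : ∀ p → ¬ Crossing p p
  crossing-irrefl (x , y) (inj₁ (x<x , _)) = <-irrefl refl x<x
  crossing-irrefl (x , y) (inj₂ (x<x , _)) = <-irrefl refl x<x

  Blocked : Arc → List Arc → Set
  Blocked a F = Any (Crossing a) F

  blocked? : ∀ a F → Dec (Blocked a F)
  blocked? a F = any? (crossing? a) F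

  -- The …Step helpers receive the decisions as arguments, so that proofs can split on them with `with`.
  solidStep : ∀ {P Q : Set} → Dec P → Dec Q → Arc → List Arc → List Arc
  solidStep (yes _) (no _)  a F = a ∷ F
  solidStep (yes _) (yes _) a F = F
  solidStep (no _)  _       a F = F

  solid : (as : List Arc) → Vec A (length as) → List Arc
  solid []       []  = []
  solid (a ∷ as) c  = solidStep (diagonal? a) (Vec.head c ≟ unit) a (solid as (Vec.tail c))

  nonunits : List A
  nonunits = filter (λ x → ¬? (x ≟ unit)) elements

  extensionsStep : ∀ {P Q : Set} {k} → Dec P → Dec Q → Vec A k → List (Vec A (suc k))
  extensionsStep (yes _) (yes _) c = (unit ∷ c) ∷ []
  extensionsStep (yes _) (no _)  c = (unit ∷ c) ∷ map (_∷ c) nonunits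
  extensionsStep (no _)  _       c = map (_∷ c) elements

  extensions : (a : Arc) (as : List Arc) → Vec A (length as) → List (Vec A (suc (length as)))
  extensions a as c = extensionsStep (diagonal? a) (blocked? a (solid as c)) c

  enumerate : (as : List Arc) → List (Vec A (length as))
  enumerate []       = [] ∷ []
  enumerate (a ∷ as) = concatMap (extensions a as) (enumerate as)

  StepwiseNoncrossing : (as : List Arc) → Vec A (length as) → Set
  StepwiseNoncrossing []       []      = ⊤
  StepwiseNoncrossing (a ∷ as) (l ∷ c) =
    StepwiseNoncrossing as c × (Diagonal a → l ≢ unit → ¬ Blocked a (solid as c))

  PairwiseNoncrossing : (as : List Arc) → Vec A (length as) → Set
  PairwiseNoncrossing as c = ∀ (i j : Fin (length as)) → Diagonal (lookup as i) → Diagonal (lookup as j) →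
    Vec.lookup c i ≢ unit → Vec.lookup c j ≢ unit → ¬ Crossing (lookup as i) (lookup as j)

  ∈-extensions⁻ : ∀ a as c l c₀ → (l ∷ c₀) ∈ extensions a as c →
                  c₀ ≡ c × (Diagonal a → l ≢ unit → ¬ Blocked a (solid as c))
  ∈-extensions⁻ a as c l c₀ l∷c₀∈ with diagonal? a | blocked? a (solid as c)
  ... | yes _ | yes _ with l∷c₀∈
  ...   | here eq = ∷-injectiveʳ eq , λ _ l≢unit _ → l≢unit (∷-injectiveˡ eq)
  ∈-extensions⁻ a as c l c₀ l∷c₀∈ | yes _ | no unblocked = tail-of l∷c₀∈ , λ _ _ → unblocked
    where
    tail-of : (l ∷ c₀) ∈ ((unit ∷ c) ∷ map (_∷ c) nonunits) → c₀ ≡ c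
    tail-of (here eq)  = proj₂ (∷-injective eq)
    tail-of (there l∷c₀∈′) with ∈-map⁻ (_∷ c) l∷c₀∈′
    ... | _ , _ , eq = proj₂ (∷-injective eq)
  ∈-extensions⁻ a as c l c₀ l∷c₀∈ | no ¬diagonal | _ with ∈-map⁻ (_∷ c) l∷c₀∈
  ... | _ , _ , eq = proj₂ (∷-injective eq) , λ d → contradiction d ¬diagonal

  ∈-extensions⁺ : ∀ a as c l → (Diagonal a → l ≢ unit → ¬ Blocked a (solid as c)) →
                  (l ∷ c) ∈ extensions a as c
  ∈-extensions⁺ a as c l allowed with diagonal? a | blocked? a (solid as c) | l ≟ unit
  ... | yes _ | yes _       | yes refl   = here refl
  ... | yes d | yes blocked | no l≢unit  = contradiction blocked (allowed d l≢unit)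
  ... | yes _ | no _        | yes refl   = here refl
  ... | yes _ | no _        | no l≢unit  =
    there (∈-map⁺ (_∷ c) (∈-filter⁺ (λ x → ¬? (x ≟ unit)) (elements-complete l) l≢unit))
  ... | no _  | _           | _          = ∈-map⁺ (_∷ c) (elements-complete l)

  ∈-enumerate⁻ : ∀ as c → c ∈ enumerate as → StepwiseNoncrossing as c
  ∈-enumerate⁻ []       []       _    = tt
  ∈-enumerate⁻ (a ∷ as) (l ∷ c₀) l∷c₀∈ with find (∈-concatMap⁻ (extensions a as) {xs = enumerate as} l∷c₀∈)
  ... | c , c∈ , l∷c₀∈′ with ∈-extensions⁻ a as c l c₀ l∷c₀∈′
  ... | refl , allowed = ∈-enumerate⁻ as c₀ c∈ , allowed

  ∈-enumerate⁺ : ∀ as c → StepwiseNoncrossing as c → c ∈ enumerate as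
  ∈-enumerate⁺ []       []       _                = here refl
  ∈-enumerate⁺ (a ∷ as) (l ∷ c₀) (nc , allowed) =
    ∈-concatMap⁺ (extensions a as) {xs = enumerate as}
      (Any.map (λ { refl → ∈-extensions⁺ a as c₀ l allowed }) (∈-enumerate⁺ as c₀ nc))

  unique-concatMap : ∀ {X Y : Set} (f : X → List Y) xs → Unique xs → (∀ x → Unique (f x)) →
                     (∀ x y z → z ∈ f x → z ∈ f y → x ≡ y) → Unique (concatMap f xs)
  unique-concatMap f []       _            _        _        = []
  unique-concatMap f (x ∷ xs) (x∉xs ∷ xs!) f-unique f-disjoint =
    Unique.++⁺ (f-unique x) (unique-concatMap f xs xs! f-unique f-disjoint) disjoint
    where
    disjoint : ∀ {v} → ¬ (v ∈ f x × v ∈ concatMap f xs)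
    disjoint (v∈fx , v∈rest) with find (∈-concatMap⁻ f {xs = xs} v∈rest)
    ... | y , y∈xs , v∈fy with f-disjoint x y _ v∈fx v∈fy
    ... | refl = All.lookup x∉xs y∈xs refl

  ∈-extensions⇒tail : ∀ a as c z → z ∈ extensions a as c → Vec.tail z ≡ c
  ∈-extensions⇒tail a as c z z∈ with diagonal? a | blocked? a (solid as c)
  ... | yes _ | yes _ with z∈
  ...   | here refl = refl
  ∈-extensions⇒tail a as c z z∈ | yes _ | no _ with z∈
  ... | here refl = refl
  ... | there z∈′ with ∈-map⁻ (_∷ c) z∈′
  ...   | _ , _ , refl = refl
  ∈-extensions⇒tail a as c z z∈ | no _ | _ with ∈-map⁻ (_∷ c) z∈
  ... | _ , _ , refl = refl

  nonunits-unique : Unique nonunits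
  nonunits-unique = Unique.filter⁺ (λ x → ¬? (x ≟ unit)) elements-unique

  extensions-unique : ∀ a as c → Unique (extensions a as c)
  extensions-unique a as c with diagonal? a | blocked? a (solid as c)
  ... | yes _ | yes _ = [] ∷ []
  ... | yes _ | no _  = All.tabulate unit∉ ∷ Unique.map⁺ ∷-injectiveˡ nonunits-unique
    where
    unit∉ : ∀ {z} → z ∈ map (_∷ c) nonunits → unit ∷ c ≢ z
    unit∉ z∈ eq with ∈-map⁻ (_∷ c) z∈
    ... | x , x∈ , refl = proj₂ (∈-filter⁻ (λ x → ¬? (x ≟ unit)) {xs = elements} x∈) (sym (∷-injectiveˡ eq))
  ... | no _  | _     = Unique.map⁺ ∷-injectiveˡ elements-unique

  enumerate-unique : ∀ as → Unique (enumerate as)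
  enumerate-unique []       = [] ∷ []
  enumerate-unique (a ∷ as) =
    unique-concatMap (extensions a as) (enumerate as) (enumerate-unique as) (extensions-unique a as)
      (λ x y z z∈x z∈y → trans (sym (∈-extensions⇒tail a as x z z∈x)) (∈-extensions⇒tail a as y z z∈y))

  ∈-solid⁻ : ∀ as c f → f ∈ solid as c →
             Σ (Fin (length as)) λ j → lookup as j ≡ f × Diagonal f × Vec.lookup c j ≢ unit
  ∈-solid⁻ []       []      f ()
  ∈-solid⁻ (a ∷ as) (l ∷ c) f f∈ with diagonal? a | l ≟ unit
  ... | yes d | no l≢unit with f∈
  ...   | here refl = zero , refl , d , l≢unit
  ...   | there f∈′ with ∈-solid⁻ as c f f∈′
  ...     | j , eq , df , ne = suc j , eq , df , ne
  ∈-solid⁻ (a ∷ as) (l ∷ c) f f∈ | yes _ | yes _ with ∈-solid⁻ as c f f∈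
  ... | j , eq , df , ne = suc j , eq , df , ne
  ∈-solid⁻ (a ∷ as) (l ∷ c) f f∈ | no _ | _ with ∈-solid⁻ as c f f∈
  ... | j , eq , df , ne = suc j , eq , df , ne

  ∈-solid⁺ : ∀ as c (j : Fin (length as)) → Diagonal (lookup as j) → Vec.lookup c j ≢ unit →
             lookup as j ∈ solid as c
  ∈-solid⁺ (a ∷ as) (l ∷ c) zero d ne with diagonal? a | l ≟ unit
  ... | yes _  | no _      = here refl
  ... | yes _  | yes l≡unit = contradiction l≡unit ne
  ... | no ¬d  | _         = contradiction d ¬d
  ∈-solid⁺ (a ∷ as) (l ∷ c) (suc j) d ne with diagonal? a | l ≟ unit
  ... | yes _ | no _  = there (∈-solid⁺ as c j d ne)
  ... | yes _ | yes _ = ∈-solid⁺ as c j d ne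
  ... | no _  | _     = ∈-solid⁺ as c j d ne

  pairwise⇒stepwise : ∀ as c → PairwiseNoncrossing as c → StepwiseNoncrossing as c
  pairwise⇒stepwise []       []      _  = tt
  pairwise⇒stepwise (a ∷ as) (l ∷ c) nc = pairwise⇒stepwise as c (λ i j → nc (suc i) (suc j)) , allowed
    where
    allowed : Diagonal a → l ≢ unit → ¬ Blocked a (solid as c)
    allowed d ne blocked with find blocked
    ... | f , f∈ , crosses with ∈-solid⁻ as c f f∈
    ... | j , refl , df , nej = nc zero (suc j) d df ne nej crosses

  stepwise⇒pairwise : ∀ as c → StepwiseNoncrossing as c → PairwiseNoncrossing as c
  stepwise⇒pairwise (a ∷ as) (l ∷ c) (nc , allowed) zero    zero    _ _  _   _   = crossing-irrefl a
  stepwise⇒pairwise (a ∷ as) (l ∷ c) (nc , allowed) zero    (suc j) d dj ne nej crosses =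
    allowed d ne (Any.map (λ { refl → crosses }) (∈-solid⁺ as c j dj nej))
  stepwise⇒pairwise (a ∷ as) (l ∷ c) (nc , allowed) (suc i) zero    di d nei ne crosses =
    allowed d ne (Any.map (λ { refl → crossing-sym _ _ crosses }) (∈-solid⁺ as c i di nei))
  stepwise⇒pairwise (a ∷ as) (l ∷ c) (nc , allowed) (suc i) (suc j) = stepwise⇒pairwise as c nc i j

  transferStep : ∀ {P Q : Set} → Dec P → Dec Q → (List Arc → ℕ) → Arc → List Arc → ℕ
  transferStep (yes _) (yes _) φ a F = φ F
  transferStep (yes _) (no _)  φ a F = φ F + (m ∸ 1) * φ (a ∷ F)
  transferStep (no _)  _       φ a F = m * φ F

  transfer : Arc → (List Arc → ℕ) → List Arc → ℕ
  transfer a φ F = transferStep (diagonal? a) (blocked? a F) φ a F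

  transfers : List Arc → (List Arc → ℕ) → List Arc → ℕ
  transfers []       φ = φ
  transfers (b ∷ bs) φ = transfers bs (transfer b φ)

  count : (List Arc → ℕ) → List Arc → ℕ
  count φ as = sum (map (λ c → φ (solid as c)) (enumerate as))

  length-filter-≢ : ∀ xs → Unique xs → unit ∈ xs →
                    suc (length (filter (λ x → ¬? (x ≟ unit)) xs)) ≡ length xs
  length-filter-≢ (y ∷ ys) (y∉ys ∷ ys!) unit∈ with y ≟ unit
  ... | yes refl = cong suc (cong length (List.filter-all (λ x → ¬? (x ≟ y)) (All.map (λ ne eq → ne (sym eq)) y∉ys)))
  ... | no y≢unit with unit∈
  ...   | here unit≡y  = contradiction (sym unit≡y) y≢unit
  ...   | there unit∈′ = cong suc (length-filter-≢ ys ys! unit∈′)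

  length-nonunits : length nonunits ≡ m ∸ 1
  length-nonunits = cong (_∸ 1) (length-filter-≢ elements elements-unique (elements-complete unit))

  count-extensions : ∀ φ a as c →
    sum (map (λ c′ → φ (solid (a ∷ as) c′)) (extensions a as c)) ≡ transfer a φ (solid as c)
  count-extensions φ a as c with diagonal? a | blocked? a (solid as c)
  ... | yes _ | yes _ with unit ≟ unit
  ...   | yes _        = +-identityʳ _
  ...   | no unit≢unit = contradiction refl unit≢unit
  count-extensions φ a as c | yes d | no _ with unit ≟ unit
  ... | no unit≢unit = contradiction refl unit≢unit
  ... | yes _        =
    cong (φ (solid as c) +_)
      (trans (cong sum (sym (List.map-∘ nonunits)))
             (trans (sum-map-const _ (φ (a ∷ solid as c)) nonunits solid-nonunit) (cong (_* φ (a ∷ solid as c)) length-nonunits)))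
    where
    solid-nonunit : ∀ l → l ∈ nonunits → φ (solidStep (yes d) (l ≟ unit) a (solid as c)) ≡ φ (a ∷ solid as c)
    solid-nonunit l l∈ with l ≟ unit
    ... | no _       = refl
    ... | yes l≡unit = contradiction l≡unit (proj₂ (∈-filter⁻ (λ x → ¬? (x ≟ unit)) {xs = elements} l∈))
  count-extensions φ a as c | no _ | _ =
    trans (cong sum (sym (List.map-∘ elements))) (sum-map-const _ (φ (solid as c)) elements (λ _ _ → refl))

  count-∷ : ∀ φ a as → count φ (a ∷ as) ≡ count (transfer a φ) as
  count-∷ φ a as = trans (sum-map-concatMap (λ c′ → φ (solid (a ∷ as) c′)) (extensions a as) (enumerate as))
                         (cong sum (List.map-cong (count-extensions φ a as) (enumerate as)))

  count-++ : ∀ bs as φ → count φ (bs ++ as) ≡ count (transfers bs φ) as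
  count-++ []       as φ = refl
  count-++ (b ∷ bs) as φ = trans (count-∷ φ b (bs ++ as)) (count-++ bs as (transfer b φ))

  count-cong : ∀ as φ ψ → (∀ c → φ (solid as c) ≡ ψ (solid as c)) → count φ as ≡ count ψ as
  count-cong as φ ψ φ≗ψ = cong sum (List.map-cong φ≗ψ (enumerate as))

  count-+ : ∀ as φ ψ → count (λ F → φ F + ψ F) as ≡ count φ as + count ψ as
  count-+ as φ ψ = sum-map-+ (λ c → φ (solid as c)) (λ c → ψ (solid as c)) (enumerate as)

  count-* : ∀ as k φ → count (λ F → k * φ F) as ≡ k * count φ as
  count-* as k φ = sum-map-* k (λ c → φ (solid as c)) (enumerate as)

  count-0 : ∀ as → count (λ _ → 0) as ≡ 0
  count-0 as = count-* as 0 (λ _ → 0)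

  length-enumerate : ∀ as → length (enumerate as) ≡ count (λ _ → 1) as
  length-enumerate as = sym (trans (sum-map-const (λ c → 1) 1 (enumerate as) (λ _ _ → refl)) (*-identityʳ _))

  solid-All : ∀ {P : Arc → Set} as c → All P as → All P (solid as c)
  solid-All []       []      _          = []
  solid-All (a ∷ as) (l ∷ c) (pa ∷ pas) with diagonal? a | l ≟ unit
  ... | yes _ | no _  = pa ∷ solid-All as c pas
  ... | yes _ | yes _ = solid-All as c pas
  ... | no _  | _     = solid-All as c pas

  count-cong-All : ∀ {P : Arc → Set} as φ ψ → All P as → (∀ F → All P F → φ F ≡ ψ F) →
                   count φ as ≡ count ψ as
  count-cong-All as φ ψ all-P φ≗ψ = count-cong as φ ψ (λ c → φ≗ψ (solid as c) (solid-All as c all-P))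

  ∈-enumerate⇔ : ∀ as c → (c ∈ enumerate as) ⇔ PairwiseNoncrossing as c
  ∈-enumerate⇔ as c = mk⇔ (λ c∈ → stepwise⇒pairwise as c (∈-enumerate⁻ as c c∈))
                          (λ nc → ∈-enumerate⁺ as c (pairwise⇒stepwise as c nc))

module Polygon {A : Set} (_≟_ : DecidableEquality A) (unit : A) (elements : List A)
  (elements-unique : Unique elements) (elements-complete : ∀ x → x ∈ elements) (n : ℕ) where

  open import Data.Nat hiding (_≟_)
  import Data.Nat as ℕ
  open import Data.Nat.Properties hiding (_≟_)
  open import Data.List using ([]; _∷_; _++_; map; upTo; applyUpTo; concatMap)
  import Data.List.Properties as List
  open import Data.List.Relation.Unary.Any as Any using (Any; here; there; any?)
  open import Data.List.Relation.Unary.Any.Properties using (++⁻; ++⁺ʳ)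
  open import Data.List.Relation.Unary.All as All using (All; []; _∷_)
  open import Data.List.Membership.Propositional using (find; lose)
  open import Data.Product using (_×_; _,_; proj₁; proj₂)
  open import Data.Sum using (inj₁; inj₂)
  open import Relation.Nullary using (¬_; Dec; yes; no; ¬?; contradiction)
  open import Relation.Nullary.Decidable using (_×-dec_)
  open import Relation.Unary using (Decidable)
  open import Relation.Binary.PropositionalEquality
  open import Data.Nat.Tactic.RingSolver using (solve-∀)

  OnRange : ℕ → ℕ → (ℕ → Set) → Set
  OnRange y L P = ∀ t → y ≤ t → t < y + L → P t

  diagonal? : Decidable (IsDiagonal n)
  diagonal? (x , y) = ((x + 1) <? y) ×-dec ¬? ((x ℕ.≟ 1) ×-dec (y ℕ.≟ n + 1))

  open Enumeration _≟_ unit elements elements-unique elements-complete (IsDiagonal n) diagonal? public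

  1≤m : 1 ≤ m
  1≤m = subst (1 ≤_) (length-filter-≢ elements elements-unique (elements-complete unit)) (s≤s z≤n)

  OnRange-suc : ∀ {y L P} → OnRange y (suc L) P → P y × OnRange (suc y) L P
  OnRange-suc {y} {L} h =
    h y ≤-refl y<y+1+L , λ t y<t t<1+y+L → h t (<⇒≤ y<t) (subst (t <_) (sym (+-suc y L)) t<1+y+L)
    where
    y<y+1+L : y < y + suc L
    y<y+1+L = m<m+n y (s≤s z≤n)

  Covers : ℕ → Arc → Set
  Covers t (a , b) = a < t × t < b

  Covered : List Arc → ℕ → Set
  Covered F t = Any (Covers t) F

  covered? : ∀ F t → Dec (Covered F t)
  covered? F t = any? (λ { (a , b) → (a <? t) ×-dec (t <? b) }) F

  oneIfNo : ∀ {P : Set} → Dec P → ℕ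
  oneIfNo (yes _) = 0
  oneIfNo (no _)  = 1

  oneIfNo-covered : ∀ F t → Covered F t → oneIfNo (covered? F t) ≡ 0
  oneIfNo-covered F t c with covered? F t
  ... | yes _ = refl
  ... | no ¬c = contradiction c ¬c

  oneIfNo-uncovered : ∀ F t → ¬ Covered F t → oneIfNo (covered? F t) ≡ 1
  oneIfNo-uncovered F t ¬c with covered? F t
  ... | yes c = contradiction c ¬c
  ... | no _  = refl

  oneIfNo-cong : ∀ {P Q : Set} (p : Dec P) (q : Dec Q) → (P → Q) → (Q → P) → oneIfNo p ≡ oneIfNo q
  oneIfNo-cong (yes _) (yes _) _ _ = refl
  oneIfNo-cong (no _)  (no _)  _ _ = refl
  oneIfNo-cong (yes p) (no ¬q) f _ = contradiction (f p) ¬q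
  oneIfNo-cong (no ¬p) (yes q) _ g = contradiction (g q) ¬p

  visible : List Arc → ℕ → ℕ → ℕ
  visible F lo zero      = 0
  visible F lo (suc len) = oneIfNo (covered? F lo) + visible F (suc lo) len

  visible-cong : ∀ F G lo len → OnRange lo len (λ t → (Covered F t → Covered G t) × (Covered G t → Covered F t)) →
                 visible F lo len ≡ visible G lo len
  visible-cong F G lo zero      h = refl
  visible-cong F G lo (suc len) h with OnRange-suc h
  ... | (f , g) , h′ = cong₂ _+_ (oneIfNo-cong (covered? F lo) (covered? G lo) f g) (visible-cong F G (suc lo) len h′)

  visible-+ : ∀ F lo a b → visible F lo (a + b) ≡ visible F lo a + visible F (lo + a) b
  visible-+ F lo zero    b = cong (λ z → visible F z b) (sym (+-identityʳ lo))
  visible-+ F lo (suc a) b =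
    trans (cong (oneIfNo (covered? F lo) +_)
                (trans (visible-+ F (suc lo) a b) (cong (λ z → visible F (suc lo) a + visible F z b) (sym (+-suc lo a)))))
          (sym (+-assoc (oneIfNo (covered? F lo)) _ _))

  visible-suc : ∀ F lo L → visible F lo (suc L) ≡ visible F lo L + oneIfNo (covered? F (lo + L))
  visible-suc F lo L =
    trans (cong (visible F lo) (+-comm 1 L)) (trans (visible-+ F lo L 1) (cong (visible F lo L +_) (+-identityʳ _)))

  visible≤ : ∀ F lo len → visible F lo len ≤ len
  visible≤ F lo zero      = z≤n
  visible≤ F lo (suc len) = +-mono-≤ (oneIfNo≤1 (covered? F lo)) (visible≤ F (suc lo) len)
    where
    oneIfNo≤1 : ∀ {P : Set} (d : Dec P) → oneIfNo d ≤ 1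
    oneIfNo≤1 (yes _) = z≤n
    oneIfNo≤1 (no _)  = s≤s z≤n

  visible-covered : ∀ F lo len → OnRange lo len (Covered F) → visible F lo len ≡ 0
  visible-covered F lo zero      h = refl
  visible-covered F lo (suc len) h with OnRange-suc h
  ... | c , h′ = cong₂ _+_ (oneIfNo-covered F lo c) (visible-covered F (suc lo) len h′)

  covered-∷ : ∀ b F t → ¬ Covers t b → (Covered (b ∷ F) t → Covered F t) × (Covered F t → Covered (b ∷ F) t)
  covered-∷ b F t ¬c = (λ { (here c) → contradiction c ¬c ; (there c) → c }) , there

  Within : ℕ → Arc → Set
  Within lo (a , b) = lo ≤ a × b ≤ suc n

  uncovered-≤ : ∀ lo F → All (Within lo) F → ∀ t → t ≤ lo → ¬ Covered F t
  uncovered-≤ lo F within t t≤lo c with find c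
  ... | _ , f∈ , (a<t , _) = <-irrefl refl (<-≤-trans a<t (≤-trans t≤lo (proj₁ (All.lookup within f∈))))

  uncovered-top : ∀ lo F → All (Within lo) F → ¬ Covered F (suc n)
  uncovered-top lo F within c with find c
  ... | _ , f∈ , (_ , t<b) = <-irrefl refl (<-≤-trans t<b (proj₂ (All.lookup within f∈)))

  blocked⇔covered : ∀ x y F → All (Within (suc x)) F →
                    (Blocked (x , y) F → Covered F y) × (Covered F y → Blocked (x , y) F)
  blocked⇔covered x y F within = via to , via from
    where
    via : ∀ {P Q : Arc → Set} → (∀ {p} → p ∈ F → P p → Q p) → Any P F → Any Q F
    via f a with find a
    ... | _ , p∈ , p = lose p∈ (f p∈ p)
    to : ∀ {p} → p ∈ F → Crossing (x , y) p → Covers y p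
    to p∈ (inj₁ (_ , a<y , y<b)) = a<y , y<b
    to p∈ (inj₂ (a<x , _))       = contradiction (<-trans a<x (proj₁ (All.lookup within p∈))) (<-irrefl refl)
    from : ∀ {p} → p ∈ F → Covers y p → Crossing (x , y) p
    from p∈ (a<y , y<b) = inj₁ (proj₁ (All.lookup within p∈) , a<y , y<b)

  sameLeft-¬crossing : ∀ x y y′ → ¬ Crossing (x , y) (x , y′)
  sameLeft-¬crossing x y y′ (inj₁ (x<x , _)) = <-irrefl refl x<x
  sameLeft-¬crossing x y y′ (inj₂ (x<x , _)) = <-irrefl refl x<x

  transfers-++ : ∀ xs ys φ F → transfers (xs ++ ys) φ F ≡ transfers ys (transfers xs φ) F
  transfers-++ []       ys φ F = refl
  transfers-++ (x ∷ xs) ys φ F = transfers-++ xs ys (transfer x φ) F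

  weightStep : ∀ {P Q : Set} → Dec P → Dec Q → ℕ
  weightStep (yes _) (yes _) = 1
  weightStep (yes _) (no _)  = m
  weightStep (no _)  _       = m

  weight : Arc → List Arc → ℕ
  weight b G = weightStep (diagonal? b) (blocked? b G)

  weightProduct : List Arc → List Arc → ℕ
  weightProduct []       G = 1
  weightProduct (b ∷ bs) G = weight b G * weightProduct bs G

  transfer-weight : ∀ b φ G → φ (b ∷ G) ≡ φ G → transfer b φ G ≡ weight b G * φ G
  transfer-weight b φ G φ-insensitive with diagonal? b | blocked? b G
  ... | yes _ | yes _ = sym (+-identityʳ (φ G))
  ... | yes _ | no _  = trans (cong (λ z → φ G + (m ∸ 1) * z) φ-insensitive) (cong (_* φ G) (m+[n∸m]≡n 1≤m))
  ... | no _  | _     = refl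

  transfer-insensitive : ∀ b φ G S → (Blocked b (S ++ G) → Blocked b G) → (Blocked b G → Blocked b (S ++ G)) →
    φ (S ++ G) ≡ φ G → φ (b ∷ S ++ G) ≡ φ (b ∷ G) → transfer b φ (S ++ G) ≡ transfer b φ G
  transfer-insensitive b φ G S to from φ≡ φb≡ with diagonal? b | blocked? b (S ++ G) | blocked? b G
  ... | no _  | _         | _         = cong (m *_) φ≡
  ... | yes _ | yes _     | yes _     = φ≡
  ... | yes _ | no _      | no _      = cong₂ (λ p q → p + (m ∸ 1) * q) φ≡ φb≡
  ... | yes _ | yes bl    | no ¬bl    = contradiction (to bl) ¬bl
  ... | yes _ | no ¬bl    | yes bl    = contradiction (from bl) ¬bl

  -- When neither φ nor the blocking of arcs of kind Same notices further arcs of that kind, the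
  -- transfers along such arcs are independent: each multiplies φ by its number of admissible labels.
  transfers-product : ∀ (Same : Arc → Set) bs φ G → All Same bs →
    (∀ S → All Same S → φ (S ++ G) ≡ φ G) →
    (∀ b S → Same b → All Same S → (Blocked b (S ++ G) → Blocked b G) × (Blocked b G → Blocked b (S ++ G))) →
    transfers bs φ G ≡ weightProduct bs G * φ G
  transfers-product Same []       φ G _          _         _         = sym (+-identityʳ (φ G))
  transfers-product Same (b ∷ bs) φ G (sb ∷ sbs) φ-blind blocked-blind =
    trans (transfers-product Same bs (transfer b φ) G sbs transfer-blind blocked-blind)
          (trans (cong (weightProduct bs G *_) (transfer-weight b φ G (φ-blind (b ∷ []) (sb ∷ []))))
                 (rearrange (weightProduct bs G) (weight b G) (φ G)))
    where
    rearrange : ∀ p w f → p * (w * f) ≡ w * p * f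
    rearrange = solve-∀
    transfer-blind : ∀ S → All Same S → transfer b φ (S ++ G) ≡ transfer b φ G
    transfer-blind S sS = transfer-insensitive b φ G S (proj₁ (blocked-blind b S sb sS)) (proj₂ (blocked-blind b S sb sS))
      (φ-blind S sS) (trans (φ-blind (b ∷ S) (sb ∷ sS)) (sym (φ-blind (b ∷ []) (sb ∷ []))))

  row : ℕ → ℕ → ℕ → List Arc
  row x y zero    = []
  row x y (suc L) = (x , y) ∷ row x (suc y) L

  map-upTo≡row : ∀ x y L → map (λ j → (x , y + j)) (upTo L) ≡ row x y L
  map-upTo≡row x y zero    = refl
  map-upTo≡row x y (suc L) =
    trans (List.map-upTo (λ j → (x , y + j)) (suc L))
          (cong₂ _∷_ (cong (x ,_) (+-identityʳ y))
                     (trans (sym (List.map-upTo (λ j → (x , y + suc j)) L))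
                            (trans (List.map-cong (λ j → cong (x ,_) (+-suc y j)) (upTo L)) (map-upTo≡row x (suc y) L))))

  row-snoc : ∀ x y L → row x y (suc L) ≡ row x y L ++ (x , y + L) ∷ []
  row-snoc x y zero    = cong (λ z → (x , z) ∷ []) (sym (+-identityʳ y))
  row-snoc x y (suc L) =
    cong ((x , y) ∷_) (trans (row-snoc x (suc y) L) (cong (λ z → row x (suc y) L ++ (x , z) ∷ []) (sym (+-suc y L))))

  InRow : ℕ → ℕ → ℕ → Arc → Set
  InRow x y L (x′ , y′) = x′ ≡ x × y ≤ y′ × y′ < y + L

  row-All : ∀ x y L → All (InRow x y L) (row x y L)
  row-All x y zero    = []
  row-All x y (suc L) =
    (refl , ≤-refl , m<m+n y (s≤s z≤n))
      ∷ All.map (λ { {_ , y′} (refl , y<y′ , y′<end) → refl , <⇒≤ y<y′ , subst (y′ <_) (sym (+-suc y L)) y′<end })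
                (row-All x (suc y) L)

  weightProduct-row : ∀ x y L G F →
    OnRange y L (λ t → (Blocked (x , t) G → Covered F t) × (Covered F t → Blocked (x , t) G)) →
    OnRange y L (λ t → Covered F t → IsDiagonal n (x , t)) →
    weightProduct (row x y L) G ≡ m ^ visible F y L
  weightProduct-row x y zero    G F _       _        = refl
  weightProduct-row x y (suc L) G F blocked diagonal with OnRange-suc blocked | OnRange-suc diagonal
  ... | (to , from) , blocked′ | isDiagonal , diagonal′ =
    trans (cong₂ _*_ first (weightProduct-row x (suc y) L G F blocked′ diagonal′))
          (sym (^-distribˡ-+-* m (oneIfNo (covered? F y)) (visible F (suc y) L)))
    where
    first : weight (x , y) G ≡ m ^ oneIfNo (covered? F y)
    first with diagonal? (x , y) | blocked? (x , y) G | covered? F y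
    ... | yes _ | no _   | no _  = sym (*-identityʳ m)
    ... | no _  | no _   | no _  = sym (*-identityʳ m)
    ... | yes _ | yes _  | yes _ = refl
    ... | _     | no ¬bl | yes c = contradiction (from c) ¬bl
    ... | _     | yes bl | no ¬c = contradiction (to bl) ¬c
    ... | no ¬d | yes _  | yes c = contradiction (isDiagonal c) ¬d

  sameRow-blind : ∀ x b′ S G → proj₁ b′ ≡ x → All (λ p → proj₁ p ≡ x) S →
                  (Blocked b′ (S ++ G) → Blocked b′ G) × (Blocked b′ G → Blocked b′ (S ++ G))
  sameRow-blind x (x′ , y′) S G refl S-row = to , ++⁺ʳ S
    where
    to : Blocked (x′ , y′) (S ++ G) → Blocked (x′ , y′) G
    to bl with ++⁻ S bl
    ... | inj₂ bG = bG
    ... | inj₁ bS with find bS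
    ...   | (_ , s₂) , s∈ , cr with All.lookup S-row s∈
    ...     | refl = contradiction cr (sameLeft-¬crossing x′ y′ s₂)

  -- Σ_{1 ≤ i ≤ c} (m-1) m^i ψ(1 + h - i): the longest solid diagonal of the row ends at the i-th
  -- visible vertex after the edge, leaving 1 + (h - i) visible vertices.
  solidTail : (ℕ → ℕ) → ℕ → ℕ → ℕ
  solidTail ψ h zero    = 0
  solidTail ψ h (suc c) = solidTail ψ h c + (m ∸ 1) * m ^ suc c * ψ (suc (h ∸ suc c))

  module RowScan (lo k : ℕ) (2≤lo : 2 ≤ lo) (ψ : ℕ → ℕ)
                 (F : List Arc) (F-within : All (Within (suc lo)) F) where

    φ : List Arc → ℕ
    φ G = ψ (visible G lo (suc (suc k)))

    h : ℕ
    h = visible F (suc lo) (suc k)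

    lo≢1 : lo ≢ 1
    lo≢1 eq = <-irrefl (sym eq) 2≤lo

    lo-uncovered : ¬ Covered F lo
    lo-uncovered = uncovered-≤ (suc lo) F F-within lo (n≤1+n lo)

    lo+1-uncovered : ¬ Covered F (suc lo)
    lo+1-uncovered = uncovered-≤ (suc lo) F F-within (suc lo) ≤-refl

    h≡1+ : h ≡ suc (visible F (suc (suc lo)) k)
    h≡1+ = cong (_+ visible F (suc (suc lo)) k) (oneIfNo-uncovered F (suc lo) lo+1-uncovered)

    first-arc : transfers (row lo (suc lo) 1) φ F ≡ m * ψ (suc h) + solidTail ψ h 0
    first-arc with diagonal? (lo , suc lo)
    ... | yes d = contradiction (proj₁ d) (<-irrefl (+-comm lo 1))
    ... | no _  = trans (cong (λ z → m * ψ (z + h)) (oneIfNo-uncovered F lo lo-uncovered)) (sym (+-identityʳ _))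

    module Step (L : ℕ) (L+2≤k+1 : suc (suc L) ≤ suc k) where
      y : ℕ
      y = suc lo + suc L

      b : Arc
      b = (lo , y)

      c : ℕ
      c = visible F (suc (suc lo)) L

      G : List Arc
      G = b ∷ F

      b-diagonal : IsDiagonal n b
      b-diagonal = s≤s (+-monoʳ-≤ lo (s≤s z≤n)) , λ { (eq , _) → lo≢1 eq }

      visible-step : ∀ (d : Dec (Covered F y)) → visible F (suc (suc lo)) (suc L) ≡ c + oneIfNo d
      visible-step d =
        trans (visible-suc F (suc (suc lo)) L)
              (cong (c +_) (oneIfNo-cong _ d (subst (Covered F) end) (subst (Covered F) (sym end))))
        where
        end : suc (suc lo) + L ≡ y
        end = cong suc (sym (+-suc lo L))

      φ-blind : ∀ S → All (InRow lo (suc lo) (suc L)) S → φ (S ++ G) ≡ φ G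
      φ-blind S S-row = cong ψ (visible-cong (S ++ G) G lo (suc (suc k)) (λ t _ _ → to t , ++⁺ʳ S))
        where
        to : ∀ t → Covered (S ++ G) t → Covered G t
        to t cv with ++⁻ S cv
        ... | inj₂ cG = cG
        ... | inj₁ cS with find cS
        ...   | _ , s∈ , (s₁<t , t<s₂) with All.lookup S-row s∈
        ...     | refl , _ , s₂<y = here (s₁<t , <-trans t<s₂ s₂<y)

      blocked-blind : ∀ b′ S → InRow lo (suc lo) (suc L) b′ → All (InRow lo (suc lo) (suc L)) S →
                      (Blocked b′ (S ++ G) → Blocked b′ G) × (Blocked b′ G → Blocked b′ (S ++ G))
      blocked-blind b′ S b′-row S-row = sameRow-blind lo b′ S G (proj₁ b′-row) (All.map proj₁ S-row)

      row-weight : weightProduct (row lo (suc lo) (suc L)) G ≡ m ^ suc c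
      row-weight = trans (weightProduct-row lo (suc lo) (suc L) G F blocked diagonal)
                         (cong (m ^_) (cong (_+ c) (oneIfNo-uncovered F (suc lo) lo+1-uncovered)))
        where
        blocked : OnRange (suc lo) (suc L) (λ t → (Blocked (lo , t) G → Covered F t) × (Covered F t → Blocked (lo , t) G))
        blocked t _ _ = (λ { (here cr) → contradiction cr (sameLeft-¬crossing lo t y)
                           ; (there bl) → proj₁ (blocked⇔covered lo t F F-within) bl })
                      , (λ cv → there (proj₂ (blocked⇔covered lo t F F-within) cv))
        diagonal : OnRange (suc lo) (suc L) (λ t → Covered F t → IsDiagonal n (lo , t))
        diagonal t lo<t _ cv with m≤n⇒m<n∨m≡n lo<t
        ... | inj₂ refl = contradiction cv lo+1-uncovered
        ... | inj₁ lo+1<t = subst (_< t) (+-comm 1 lo) lo+1<t , λ { (eq , _) → lo≢1 eq }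

      module Uncovered (y-uncovered : ¬ Covered F y) where
        r : ℕ
        r = k ∸ suc L

        k+1≡ : suc k ≡ suc L + suc r
        k+1≡ = trans (cong suc (sym (m+[n∸m]≡n (≤-pred L+2≤k+1)))) (sym (+-suc (suc L) r))

        R : ℕ
        R = visible F (suc y) r

        h≡ : h ≡ suc c + suc R
        h≡ = trans (cong (visible F (suc lo)) k+1≡)
               (trans (visible-+ F (suc lo) (suc L) (suc r))
                      (cong₂ _+_ (cong (_+ c) (oneIfNo-uncovered F (suc lo) lo+1-uncovered))
                                 (cong (_+ R) (oneIfNo-uncovered F y y-uncovered))))

        visible-G : visible G lo (suc (suc k)) ≡ suc (suc R)
        visible-G = cong₂ _+_ (oneIfNo-uncovered G lo lo-free)
          (trans (cong (visible G (suc lo)) k+1≡)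
          (trans (visible-+ G (suc lo) (suc L) (suc r))
                 (cong₂ _+_ (visible-covered G (suc lo) (suc L) (λ t lo<t t<y → here (lo<t , t<y)))
                            (cong₂ _+_ (oneIfNo-uncovered G y y-free) (visible-cong G F (suc y) r beyond-y)))))
          where
          lo-free : ¬ Covered G lo
          lo-free (here (lo<lo , _)) = <-irrefl refl lo<lo
          lo-free (there cv)         = lo-uncovered cv
          y-free : ¬ Covered G y
          y-free cv = y-uncovered (proj₁ (covered-∷ b F y (λ { (_ , y<y) → <-irrefl refl y<y })) cv)
          beyond-y : OnRange (suc y) r (λ t → (Covered G t → Covered F t) × (Covered F t → Covered G t))
          beyond-y t y<t _ = covered-∷ b F t (λ { (_ , t<y) → <-irrefl refl (<-trans t<y y<t) })

        φ-G : φ G ≡ ψ (suc (h ∸ suc c))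
        φ-G = trans (cong ψ visible-G)
                    (cong (λ z → ψ (suc z)) (sym (trans (cong (_∸ suc c) h≡) (m+n∸m≡n (suc c) (suc R)))))

    scan : ∀ L → suc L ≤ suc k →
           transfers (row lo (suc lo) (suc L)) φ F ≡ m * ψ (suc h) + solidTail ψ h (visible F (suc (suc lo)) L)
    scan zero    _         = first-arc
    scan (suc L) L+2≤k+1 =
      trans (cong (λ l → transfers l φ F) (row-snoc lo (suc lo) (suc L)))
            (trans (transfers-++ (row lo (suc lo) (suc L)) (b ∷ []) φ F) last-arc)
      where
      open Step L L+2≤k+1
      ψ′ : List Arc → ℕ
      ψ′ = transfers (row lo (suc lo) (suc L)) φ
      IH : ψ′ F ≡ m * ψ (suc h) + solidTail ψ h c
      IH = scan L (<⇒≤ L+2≤k+1)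
      last-arc : transfer b ψ′ F ≡ m * ψ (suc h) + solidTail ψ h (visible F (suc (suc lo)) (suc L))
      last-arc with diagonal? b | blocked? b F
      ... | no ¬d | _ = contradiction b-diagonal ¬d
      ... | yes _ | yes bl =
        trans IH (cong (λ z → m * ψ (suc h) + solidTail ψ h z)
                       (sym (trans (visible-step (yes (proj₁ (blocked⇔covered lo y F F-within) bl))) (+-identityʳ c))))
      ... | yes _ | no ¬bl =
        trans (cong₂ (λ p q → p + (m ∸ 1) * q) IH
                     (trans (transfers-product (InRow lo (suc lo) (suc L)) (row lo (suc lo) (suc L)) φ G
                                               (row-All lo (suc lo) (suc L)) φ-blind blocked-blind)
                            (cong₂ _*_ row-weight (Uncovered.φ-G y-uncovered))))
        (trans (regroup (m * ψ (suc h)) (solidTail ψ h c) (m ∸ 1) (m ^ suc c) (ψ (suc (h ∸ suc c))))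
               (cong (λ z → m * ψ (suc h) + solidTail ψ h z) (sym (trans (visible-step (no y-uncovered)) (+-comm c 1)))))
        where
        y-uncovered : ¬ Covered F y
        y-uncovered cv = ¬bl (proj₂ (blocked⇔covered lo y F F-within) cv)
        regroup : ∀ a g w p f → a + g + w * (p * f) ≡ a + (g + w * p * f)
        regroup = solve-∀

    row-transfer : transfers (row lo (suc lo) (suc k)) φ F ≡ m * ψ (suc h) + solidTail ψ h (visible F (suc (suc lo)) k)
    row-transfer = scan k ≤-refl

  exactStep : ∀ {P : Set} → Dec P → ℕ → ℕ
  exactStep (yes _) v = m ^ v
  exactStep (no _)  _ = 0

  exact : ℕ → ℕ → ℕ
  exact v g = exactStep (v ℕ.≟ g) v

  atLeast : ℕ → ℕ → ℕ
  atLeast v g = exactStep (g ≤? v) v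

  exact-≢ : ∀ v g → v ≢ g → exact v g ≡ 0
  exact-≢ v g v≢g with v ℕ.≟ g
  ... | yes v≡g = contradiction v≡g v≢g
  ... | no _    = refl

  exact-refl : ∀ v → exact v v ≡ m ^ v
  exact-refl v with v ℕ.≟ v
  ... | yes _   = refl
  ... | no v≢v  = contradiction refl v≢v

  atLeast-≤ : ∀ v g → g ≤ v → atLeast v g ≡ m ^ v
  atLeast-≤ v g g≤v with g ≤? v
  ... | yes _   = refl
  ... | no g≰v  = contradiction g≤v g≰v

  atLeast-≰ : ∀ v g → ¬ g ≤ v → atLeast v g ≡ 0
  atLeast-≰ v g g≰v with g ≤? v
  ... | yes g≤v = contradiction g≤v g≰v
  ... | no _    = refl

  atLeast-split : ∀ v g → atLeast v g ≡ exact v g + atLeast v (suc g)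
  atLeast-split v g with v ℕ.≟ g
  ... | yes refl =
    trans (atLeast-≤ v v ≤-refl) (sym (trans (cong (m ^ v +_) (atLeast-≰ v (suc v) (<-irrefl refl))) (+-identityʳ _)))
  ... | no v≢g with g ≤? v
  ...   | yes g≤v = sym (atLeast-≤ v (suc g) (≤∧≢⇒< g≤v (λ eq → v≢g (sym eq))))
  ...   | no g≰v  = sym (atLeast-≰ v (suc g) (λ g<v → g≰v (<⇒≤ g<v)))

  module ExactTail (g h′ : ℕ) where
    ψ : ℕ → ℕ
    ψ t = exact t (suc (suc g))

    term-≢ : ∀ c → h′ ∸ c ≢ suc g → (m ∸ 1) * m ^ suc c * ψ (suc (h′ ∸ c)) ≡ 0
    term-≢ c ne = trans (cong ((m ∸ 1) * m ^ suc c *_) (exact-≢ (suc (h′ ∸ c)) (suc (suc g)) (λ eq → ne (suc-injective eq))))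
                        (*-zeroʳ ((m ∸ 1) * m ^ suc c))

    solidTail-≢ : ∀ c → (∀ c′ → c′ < c → h′ ∸ c′ ≢ suc g) → solidTail ψ (suc h′) c ≡ 0
    solidTail-≢ zero    _  = refl
    solidTail-≢ (suc c) ne = cong₂ _+_ (solidTail-≢ c (λ c′ c′<c → ne c′ (m<n⇒m<1+n c′<c))) (term-≢ c (ne c ≤-refl))

    module Reached (d : ℕ) (h′≡ : h′ ≡ d + suc g) where
      only-d : ∀ c → h′ ∸ c ≡ suc g → c ≡ d
      only-d c eq with c ≤? h′
      ... | yes c≤h′ =
        +-cancelˡ-≡ (suc g) c d (trans (cong (_+ c) (sym eq)) (trans (m∸n+n≡m c≤h′) (trans h′≡ (+-comm d (suc g)))))
      ... | no c≰h′  = contradiction (trans (sym (m≤n⇒m∸n≡0 (<⇒≤ (≰⇒> c≰h′)))) eq) (λ ())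

      at-d : solidTail ψ (suc h′) (suc d) ≡ (m ∸ 1) * m ^ suc (suc h′)
      at-d = begin
        solidTail ψ (suc h′) d + (m ∸ 1) * m ^ suc d * ψ (suc (h′ ∸ d))
          ≡⟨ cong₂ _+_ (solidTail-≢ d (λ c′ c′<d eq → <-irrefl (only-d c′ eq) c′<d))
                       (cong (λ z → (m ∸ 1) * m ^ suc d * ψ (suc z)) h′∸d) ⟩
        (m ∸ 1) * m ^ suc d * ψ (suc (suc g))
          ≡⟨ cong ((m ∸ 1) * m ^ suc d *_) (exact-refl (suc (suc g))) ⟩
        (m ∸ 1) * m ^ suc d * m ^ suc (suc g)
          ≡⟨ *-assoc (m ∸ 1) (m ^ suc d) (m ^ suc (suc g)) ⟩
        (m ∸ 1) * (m ^ suc d * m ^ suc (suc g))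
          ≡⟨ cong ((m ∸ 1) *_) (trans (sym (^-distribˡ-+-* m (suc d) (suc (suc g)))) (cong (m ^_) exponent)) ⟩
        (m ∸ 1) * m ^ suc (suc h′) ∎
        where
        open ≡-Reasoning
        h′∸d : h′ ∸ d ≡ suc g
        h′∸d = trans (cong (_∸ d) h′≡) (m+n∸m≡n d (suc g))
        exponent : suc d + suc (suc g) ≡ suc (suc h′)
        exponent = cong suc (trans (+-suc d (suc g)) (cong suc (sym h′≡)))

      after-d : ∀ t → solidTail ψ (suc h′) (suc d + t) ≡ (m ∸ 1) * m ^ suc (suc h′)
      after-d zero    = trans (cong (solidTail ψ (suc h′)) (+-identityʳ (suc d))) at-d
      after-d (suc t) =
        trans (cong (solidTail ψ (suc h′)) (+-suc (suc d) t))
              (trans (cong₂ _+_ (after-d t) (term-≢ (suc d + t) (λ eq → <-irrefl (sym (only-d (suc d + t) eq)) (s≤s (m≤m+n d t)))))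
                     (+-identityʳ _))

    solidTail-exact : solidTail ψ (suc h′) h′ ≡ (m ∸ 1) * m * atLeast (suc h′) (suc (suc g))
    solidTail-exact with suc g ≤? h′
    ... | yes g<h′ =
      trans (trans (cong (solidTail ψ (suc h′)) (trans h′≡ (+-suc d g))) (Reached.after-d d h′≡ g))
            (trans (sym (*-assoc (m ∸ 1) m (m ^ suc h′))) (cong ((m ∸ 1) * m *_) (sym (atLeast-≤ (suc h′) (suc (suc g)) (s≤s g<h′)))))
      where
      d = h′ ∸ suc g
      h′≡ : h′ ≡ d + suc g
      h′≡ = sym (m∸n+n≡m g<h′)
    ... | no g≮h′ =
      trans (solidTail-≢ h′ (λ c′ _ eq → <-irrefl refl (subst (_≤ g) eq (≤-trans (m∸n≤m h′ c′) (≤-pred (≰⇒> g≮h′))))))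
            (sym (trans (cong ((m ∸ 1) * m *_) (atLeast-≰ (suc h′) (suc (suc g)) (λ le → g≮h′ (≤-pred le)))) (*-zeroʳ ((m ∸ 1) * m))))

    first-term : m * ψ (suc (suc h′)) ≡ m * m * exact (suc h′) (suc g)
    first-term with h′ ℕ.≟ g
    ... | yes refl = trans (cong (m *_) (exact-refl (suc (suc h′))))
                           (trans (sym (*-assoc m m (m ^ suc h′))) (cong (m * m *_) (sym (exact-refl (suc h′)))))
    ... | no h′≢g  = trans (cong (m *_) (exact-≢ _ _ (λ eq → h′≢g (suc-injective (suc-injective eq)))))
                           (trans (*-zeroʳ m) (sym (trans (cong (m * m *_) (exact-≢ _ _ (λ eq → h′≢g (suc-injective eq)))) (*-zeroʳ (m * m)))))

  row-exact : ∀ lo k → 2 ≤ lo → ∀ g F → All (Within (suc lo)) F →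
    transfers (row lo (suc lo) (suc k)) (λ G → exact (visible G lo (suc (suc k))) (suc (suc g))) F
      ≡ m * m * exact (visible F (suc lo) (suc k)) (suc g) + (m ∸ 1) * m * atLeast (visible F (suc lo) (suc k)) (suc (suc g))
  row-exact lo k 2≤lo g F F-within =
    trans row-transfer
      (trans (cong (λ z → m * ψ (suc z) + solidTail ψ z h′) h≡1+)
             (trans (cong₂ _+_ first-term solidTail-exact)
                    (cong (λ z → m * m * exact z (suc g) + (m ∸ 1) * m * atLeast z (suc (suc g))) (sym h≡1+))))
    where
    h′ = visible F (suc (suc lo)) k
    open ExactTail g h′
    open RowScan lo k 2≤lo ψ F F-within

  row-constant : ∀ lo k F → All (Within (suc lo)) F →
                 transfers (row lo (suc lo) (suc k)) (λ _ → 1) F ≡ m ^ visible F (suc lo) (suc k)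
  row-constant lo k F F-within =
    trans (transfers-product (λ p → proj₁ p ≡ lo) (row lo (suc lo) (suc k)) (λ _ → 1) F
                             (All.map proj₁ (row-All lo (suc lo) (suc k))) (λ _ _ → refl) (λ b′ S → sameRow-blind lo b′ S F))
          (trans (*-identityʳ _) (weightProduct-row lo (suc lo) (suc k) F F blocked diagonal))
    where
    blocked : OnRange (suc lo) (suc k) (λ t → (Blocked (lo , t) F → Covered F t) × (Covered F t → Blocked (lo , t) F))
    blocked t _ _ = blocked⇔covered lo t F F-within
    diagonal : OnRange (suc lo) (suc k) (λ t → Covered F t → IsDiagonal n (lo , t))
    diagonal t lo<t _ cv with m≤n⇒m<n∨m≡n lo<t
    ... | inj₂ refl   = contradiction cv (uncovered-≤ (suc lo) F F-within (suc lo) ≤-refl)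
    ... | inj₁ lo+1<t = subst (_< t) (+-comm 1 lo) lo+1<t
                      , λ { (_ , t≡n+1) → uncovered-top (suc lo) F F-within (subst (Covered F) (trans t≡n+1 (+-comm n 1)) cv) }

  rowOf : ℕ → List Arc
  rowOf k = row (n ∸ k) (suc (n ∸ k)) (suc k)

  lastRows : ℕ → List Arc
  lastRows zero    = []
  lastRows (suc k) = rowOf k ++ lastRows k

  arcs≡lastRows : arcs n ≡ lastRows n
  arcs≡lastRows = from 0 n refl
    where
    arcsRow : ℕ → List Arc
    arcsRow i = map (λ j → (1 + i , 2 + i + j)) (upTo (n ∸ i))
    applyUpTo-cong : ∀ {X : Set} (f g : ℕ → X) L → (∀ j → f j ≡ g j) → applyUpTo f L ≡ applyUpTo g L
    applyUpTo-cong f g zero    f≗g = refl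
    applyUpTo-cong f g (suc L) f≗g =
      cong₂ _∷_ (f≗g 0) (applyUpTo-cong (λ j → f (suc j)) (λ j → g (suc j)) L (λ j → f≗g (suc j)))
    from : ∀ i k → i + k ≡ n → concatMap arcsRow (applyUpTo (i +_) k) ≡ lastRows k
    from i zero    _   = refl
    from i (suc k) i+k+1≡n = cong₂ _++_ first-row
      (trans (cong (concatMap arcsRow) (applyUpTo-cong _ _ k (λ t → +-suc i t))) (from (suc i) k (trans (sym (+-suc i k)) i+k+1≡n)))
      where
      n∸k : n ∸ k ≡ suc i
      n∸k = trans (cong (_∸ k) (trans (sym i+k+1≡n) (+-suc i k))) (m+n∸n≡m (suc i) k)
      n∸i : n ∸ i ≡ suc k
      n∸i = trans (cong (_∸ i) (sym i+k+1≡n)) (m+n∸m≡n i (suc k))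
      first-row : arcsRow (i + 0) ≡ rowOf k
      first-row = trans (cong arcsRow (+-identityʳ i))
                        (trans (map-upTo≡row (suc i) (suc (suc i)) (n ∸ i))
                               (trans (cong (row (suc i) (suc (suc i))) n∸i) (cong (λ x → row x (suc x) (suc k)) (sym n∸k))))

  lastRows-Within : ∀ k → k ≤ n → All (Within (suc (n ∸ k))) (lastRows k)
  lastRows-Within zero    _   = []
  lastRows-Within (suc k) k<n = All.++⁺ row-within (All.map weaken (lastRows-Within k (<⇒≤ k<n)))
    where
    open import Data.List.Relation.Unary.All.Properties as All using ()
    weaken : ∀ {p} → Within (suc (n ∸ k)) p → Within (suc (n ∸ suc k)) p
    weaken (lo≤a , b≤n+1) = ≤-trans (s≤s (∸-monoʳ-≤ n (n≤1+n k))) lo≤a , b≤n+1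
    n∸k≡ : n ∸ k ≡ suc (n ∸ suc k)
    n∸k≡ = +-∸-assoc 1 k<n
    end : n ∸ k + suc k ≡ suc n
    end = trans (+-suc (n ∸ k) k) (cong suc (m∸n+n≡m (<⇒≤ k<n)))
    row-within : All (Within (suc (n ∸ suc k))) (rowOf k)
    row-within = All.map (λ { {_ , b} (refl , _ , b<end) → ≤-reflexive (sym n∸k≡) , subst (b ≤_) end (≤-pred b<end) })
                         (row-All (n ∸ k) (suc (n ∸ k)) (suc k))

  visibleIn : ℕ → List Arc → ℕ
  visibleIn k F = visible F (suc n ∸ k) (suc k)

  suc-n∸k : ∀ k → k ≤ n → suc n ∸ k ≡ suc (n ∸ k)
  suc-n∸k k k≤n = +-∸-assoc 1 k≤n

  -- the first and the last of these vertices are never covered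
  2≤visibleIn : ∀ k F → 1 ≤ k → k ≤ n → All (Within (suc (n ∸ k))) F → 2 ≤ visibleIn k F
  2≤visibleIn (suc k) F _ k<n within = subst (λ p → 2 ≤ visible F p (suc (suc k))) (sym (suc-n∸k (suc k) k<n)) two
    where
    p = suc (n ∸ suc k)
    end : suc p + k ≡ suc n
    end = cong suc (trans (sym (+-suc (n ∸ suc k) k)) (m∸n+n≡m k<n))
    two : 2 ≤ visible F p (suc (suc k))
    two = subst (2 ≤_) (sym (cong₂ _+_ (oneIfNo-uncovered F p (uncovered-≤ p F within p ≤-refl)) (visible-suc F (suc p) k)))
            (s≤s (subst (λ z → 1 ≤ visible F (suc p) k + z)
                        (sym (trans (cong (λ t → oneIfNo (covered? F t)) end) (oneIfNo-uncovered F (suc n) (uncovered-top p F within))))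
                        (m≤n+m 1 _)))

module Counting {A : Set} (_≟_ : DecidableEquality A) (unit : A) (elements : List A)
  (elements-unique : Unique elements) (elements-complete : ∀ x → x ∈ elements) (J : ℕ) where

  open import Data.Nat hiding (_≟_)
  open import Data.Nat.Properties hiding (_≟_)
  open import Data.List using ([]; _++_; length)
  open import Data.List.Relation.Unary.All using (All)
  open import Data.Product using (_,_; proj₁)
  open import Relation.Nullary using (¬_; yes; no; contradiction)
  open import Relation.Binary.PropositionalEquality hiding (J)
  open Polygon _≟_ unit elements elements-unique elements-complete (suc (suc J)) public
  open BallotValues using (δ₁)
  open Transfer using (TransferRecurrence)

  n : ℕ
  n = suc (suc J)

  -- weighted counts of the labellings of the last j + 1 rows leaving exactly, resp. at least,
  -- g + 1 visible vertices among the last j + 2 vertices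
  weightExact weightAtLeast : ℕ → ℕ → List Arc → ℕ
  weightExact   j g F = exact   (visibleIn (suc j) F) (suc g)
  weightAtLeast j g F = atLeast (visibleIn (suc j) F) (suc g)

  N A≥ : ℕ → ℕ → ℕ
  N  j g = count (weightExact j g)   (lastRows (suc j))
  A≥ j g = count (weightAtLeast j g) (lastRows (suc j))

  1+j≤n : ∀ j → j ≤ J → suc j ≤ n
  1+j≤n j j≤J = ≤-trans (s≤s j≤J) (n≤1+n (suc J))

  N-initial : ∀ g → N 0 g ≡ m ^ 3 * δ₁ g
  N-initial g = trans (count-∷ φ (n , suc n) []) (trans (+-identityʳ _) last-arc)
    where
    φ : List Arc → ℕ
    φ F = exact (visibleIn 1 F) (suc g)
    base : ∀ g → m * exact 2 (suc g) ≡ m ^ 3 * δ₁ g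
    base zero          = trans (cong (m *_) (exact-≢ 2 1 (λ ()))) (trans (*-zeroʳ m) (sym (*-zeroʳ (m ^ 3))))
    base (suc zero)    = trans (cong (m *_) (exact-refl 2)) (sym (*-identityʳ (m ^ 3)))
    base (suc (suc g)) = trans (cong (m *_) (exact-≢ 2 (3 + g) (λ ()))) (trans (*-zeroʳ m) (sym (*-zeroʳ (m ^ 3))))
    last-arc : transfer (n , suc n) φ [] ≡ m ^ 3 * δ₁ g
    last-arc with diagonal? (n , suc n)
    ... | yes d = contradiction (proj₁ d) (<-irrefl (+-comm n 1))
    ... | no _  = base g

  N-zero : ∀ j → j ≤ J → N j 0 ≡ 0
  N-zero j j≤J =
    trans (count-cong-All (lastRows (suc j)) (weightExact j 0) (λ _ → 0) (lastRows-Within (suc j) (1+j≤n j j≤J))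
                          (λ F within → exact-≢ (visibleIn (suc j) F) 1
                                          (λ v≡1 → <-irrefl (sym v≡1) (2≤visibleIn (suc j) F (s≤s z≤n) (1+j≤n j j≤J) within))))
          (count-0 (lastRows (suc j)))

  A-split : ∀ j g → A≥ j g ≡ N j g + A≥ j (suc g)
  A-split j g =
    trans (count-cong (lastRows (suc j)) (weightAtLeast j g) (λ F → weightExact j g F + weightAtLeast j (suc g) F)
                      (λ c → atLeast-split (visibleIn (suc j) (solid (lastRows (suc j)) c)) (suc g)))
          (count-+ (lastRows (suc j)) (weightExact j g) (weightAtLeast j (suc g)))

  A-vanish : ∀ j g → suc (suc j) ≤ g → A≥ j g ≡ 0
  A-vanish j g j+2≤g =
    trans (count-cong (lastRows (suc j)) (weightAtLeast j g) (λ _ → 0)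
                      (λ c → atLeast-≰ (visibleIn (suc j) (solid (lastRows (suc j)) c)) (suc g) (too-many c)))
          (count-0 (lastRows (suc j)))
    where
    too-many : ∀ c → ¬ suc g ≤ visibleIn (suc j) (solid (lastRows (suc j)) c)
    too-many c g<v =
      <-irrefl refl (≤-trans (s≤s j+2≤g) (≤-trans g<v (visible≤ (solid (lastRows (suc j)) c) (suc n ∸ suc j) (suc (suc j)))))

  N-suc : ∀ j g → j < J → N (suc j) (suc g) ≡ m * m * N j g + (m ∸ 1) * m * A≥ j (suc g)
  N-suc j g j<J = begin
    count (weightExact (suc j) (suc g)) (rowOf (suc j) ++ lastRows (suc j))
      ≡⟨ count-++ (rowOf (suc j)) (lastRows (suc j)) (weightExact (suc j) (suc g)) ⟩
    count (transfers (rowOf (suc j)) (weightExact (suc j) (suc g))) (lastRows (suc j))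
      ≡⟨ count-cong-All (lastRows (suc j)) _ next (lastRows-Within (suc j) (1+j≤n j (<⇒≤ j<J))) next-row ⟩
    count next (lastRows (suc j))
      ≡⟨ count-+ (lastRows (suc j)) (λ F → m * m * weightExact j g F) (λ F → (m ∸ 1) * m * weightAtLeast j (suc g) F) ⟩
    count (λ F → m * m * weightExact j g F) (lastRows (suc j))
      + count (λ F → (m ∸ 1) * m * weightAtLeast j (suc g) F) (lastRows (suc j))
      ≡⟨ cong₂ _+_ (count-* (lastRows (suc j)) (m * m) (weightExact j g))
                   (count-* (lastRows (suc j)) ((m ∸ 1) * m) (weightAtLeast j (suc g))) ⟩
    m * m * N j g + (m ∸ 1) * m * A≥ j (suc g) ∎
    where
    open ≡-Reasoning
    next : List Arc → ℕ
    next F = m * m * weightExact j g F + (m ∸ 1) * m * weightAtLeast j (suc g) F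
    lo = n ∸ suc j
    2≤lo : 2 ≤ lo
    2≤lo = m+n≤o⇒m≤o∸n 2 (s≤s (s≤s j<J))
    next-row : ∀ F → All (Within (suc lo)) F → transfers (rowOf (suc j)) (weightExact (suc j) (suc g)) F ≡ next F
    next-row F within =
      trans (row-exact lo (suc j) 2≤lo g F within)
            (cong (λ p → m * m * exact (visible F p (suc (suc j))) (suc g)
                         + (m ∸ 1) * m * atLeast (visible F p (suc (suc j))) (suc (suc g)))
                  (sym (suc-n∸k (suc j) (1+j≤n j (<⇒≤ j<J)))))

  recurrence : TransferRecurrence m J N A≥
  recurrence = record
    { N-initial = N-initial ; N-zero = N-zero ; N-suc = N-suc ; A-split = A-split ; A-vanish = A-vanish }

  length-enumerate≡A≥ : length (enumerate (arcs n)) ≡ A≥ J 1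
  length-enumerate≡A≥ =
    trans (length-enumerate (arcs n))
      (trans (cong (count (λ _ → 1)) arcs≡lastRows)
        (trans (count-++ (rowOf (suc J)) (lastRows (suc J)) (λ _ → 1))
               (count-cong-All (lastRows (suc J)) _ (weightAtLeast J 1) (lastRows-Within (suc J) J+1≤n) first-row)))
    where
    J+1≤n = 1+j≤n J ≤-refl
    first-row : ∀ F → All (Within (suc (n ∸ suc J))) F → transfers (rowOf (suc J)) (λ _ → 1) F ≡ weightAtLeast J 1 F
    first-row F within =
      trans (row-constant (n ∸ suc J) (suc J) F within)
            (trans (cong (λ p → m ^ visible F p (suc (suc J))) (sym (suc-n∸k (suc J) J+1≤n)))
                   (sym (atLeast-≤ (visibleIn (suc J) F) 2 (2≤visibleIn (suc J) F (s≤s z≤n) J+1≤n within))))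

  length-enumerate-arcs : length (enumerate (arcs n)) ≡ formula m n
  length-enumerate-arcs = trans length-enumerate≡A≥ (Transfer.transfer-solution recurrence)

module FiniteCarrier {A : Set} {m : ℕ} (A↔Fin : A ↔ Fin m) where
  open import Data.Fin.Properties using () renaming (_≟_ to _≟ᶠ_)
  open import Data.List using (List; map; length; allFin)
  open import Data.List.Properties using (length-map; length-tabulate)
  open import Data.List.Relation.Unary.Unique.Propositional using (Unique)
  import Data.List.Relation.Unary.Unique.Propositional.Properties as Unique
  open import Data.List.Membership.Propositional using (_∈_)
  open import Data.List.Membership.Propositional.Properties using (∈-map⁺; ∈-allFin)
  open import Function.Bundles using (Inverse)
  open import Relation.Binary.Definitions using (DecidableEquality)
  open import Relation.Nullary using (yes; no)
  open import Relation.Binary.PropositionalEquality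
  open Inverse A↔Fin

  from-injective : ∀ {i j} → from i ≡ from j → i ≡ j
  from-injective {i} {j} eq = trans (sym (strictlyInverseˡ i)) (trans (cong to eq) (strictlyInverseˡ j))

  _≟ᴬ_ : DecidableEquality A
  x ≟ᴬ y with to x ≟ᶠ to y
  ... | yes eq = yes (trans (sym (strictlyInverseʳ x)) (trans (cong from eq) (strictlyInverseʳ y)))
  ... | no ne  = no (λ eq → ne (cong to eq))

  elements : List A
  elements = map from (allFin m)

  elements-unique : Unique elements
  elements-unique = Unique.map⁺ from-injective (Unique.allFin⁺ m)

  elements-complete : ∀ x → x ∈ elements
  elements-complete x = subst (_∈ elements) (strictlyInverseʳ x) (∈-map⁺ from (∈-allFin (to x)))

  length-elements : length elements ≡ m
  length-elements = trans (length-map from (allFin m)) (length-tabulate (λ i → i))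

proposition3p7 : (M : UnitaryMagma) (m : ℕ) → UnitaryMagma.Carrier M ↔ Fin m →
    (n : ℕ) → 2 ≤ n → DimNC≡ M n (formula m n)
proposition3p7 M m A↔Fin (suc (suc J)) (s≤s (s≤s z≤n)) =
  enumerate (arcs n) , enumerate-unique (arcs n) , ∈-enumerate⇔ (arcs n) ,
  trans length-enumerate-arcs (cong (λ k → formula k n) length-elements)
  where
  open FiniteCarrier A↔Fin
  open Counting _≟ᴬ_ (UnitaryMagma.𝟙 M) elements elements-unique elements-complete J
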